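{- Let $H$ be a hypergraph with $R(H)=\{1,2\}$ such that the graph $H^2$ of its $2$-edges is bipartite and $H$ does not contain a closed path $\bar P_{2k}$ for any $k\ge 1$. Then $\pi(H)=1$.
   Context: A hypergraph $G=(V,E)$ has a finite vertex set and edge set $E\subseteq 2^V$ (edges may have different sizes); $R(G)=\{|F|\colon F\in E\}$. For $G$ on $n$ vertices, $h_n(G)=\sum_{F\in E(G)}1/\binom{n}{|F|}$. $H_1\subseteq H_2$ (contains) if there is an injective $f\colon V(H_1)\to V(H_2)$ with $f(F)\in E(H_2)$ for all $F\in E(H_1)$. $\pi_n(H)=\max\{h_n(G)\colon v(G)=n,\ R(G)\subseteq R(H),\ H\not\subseteq G\}$, $\pi(H)=\lim_{n\to\infty}\pi_n(H)$. The closed path $\bar P_m$ has vertices $x_1,\dots,x_m$, $1$-edges $\{x_1\},\{x_m\}$ and $2$-edges $\{x_i,x_{i+1}\}$, $1\le i\le m-1$. -}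

module Defs where

open import Data.Nat as ℕ using (ℕ; zero; suc; _+_)
open import Data.Nat.Combinatorics using (_C_)
open import Data.Bool using (Bool; true; false; if_then_else_)
open import Data.Fin using (Fin; zero; suc; fromℕ; inject₁)
open import Data.Fin.Subset using (Subset; ⁅_⁆; _∪_; ∣_∣; _∈_; ⊥)
open import Data.Vec using (Vec; []; _∷_)
open import Data.Vec.Properties using (≡-dec)
open import Data.List using (List; []; _∷_; map; _++_; foldr)
open import Data.Bool.ListAction using (any)
import Data.Bool.Properties as BP
open import Data.Integer using (+_)
open import Data.Rational as ℚ using (ℚ; 0ℚ; _/_)
open import Data.Product using (Σ; ∃; _×_; _,_)
open import Data.Sum using (_⊎_)
open import Relation.Binary.PropositionalEquality using (_≡_; _≢_)
open import Relation.Nullary using (¬_; does)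
open import Function.Definitions using (Injective)

-- A hypergraph on vertex set Fin size; the edge set E ⊆ 2^V is given by
-- its (Bool-valued) indicator function on subsets of the vertex set.
record Hypergraph : Set where
  constructor hg
  field
    size : ℕ
    edge : Subset size → Bool
open Hypergraph public

IsEdge : (G : Hypergraph) → Subset (size G) → Set
IsEdge G F = edge G F ≡ true

-- R(G) ⊆ R(H)
RSub : Hypergraph → Hypergraph → Set
RSub G H = ∀ F → IsEdge G F → ∃ λ F' → IsEdge H F' × ∣ F' ∣ ≡ ∣ F ∣

image : ∀ {a b} → (Fin a → Fin b) → Subset a → Subset b
image {zero}  f []       = ⊥
image {suc a} f (x ∷ xs) =
  (if x then ⁅ f zero ⁆ else ⊥) ∪ image (λ i → f (suc i)) xs

Contains : Hypergraph → Hypergraph → Set   -- Contains H₂ H₁ : H₁ ⊆ H₂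
Contains H₂ H₁ =
  Σ (Fin (size H₁) → Fin (size H₂)) λ f →
    Injective _≡_ _≡_ f × (∀ F → IsEdge H₁ F → IsEdge H₂ (image f F))

allSubsets : (n : ℕ) → List (Subset n)
allSubsets zero = [] ∷ []
allSubsets (suc n) = map (true ∷_) (allSubsets n) ++ map (false ∷_) (allSubsets n)

-- 1/d as a rational (d = 0 never occurs below, since C(n,|F|) ≥ 1)
inv : ℕ → ℚ
inv zero = 0ℚ
inv (suc d) = (+ 1) / suc d

h : (G : Hypergraph) → ℚ
h G = foldr ℚ._+_ 0ℚ
        (map (λ F → if edge G F then inv (size G C ∣ F ∣) else 0ℚ)
             (allSubsets (size G)))

Admissible : Hypergraph → ℕ → Hypergraph → Set
Admissible H n G = size G ≡ n × RSub G H × ¬ Contains G H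

-- x = π_n(H) (x is the maximum of h_n over admissible G)
IsPiN : Hypergraph → ℕ → ℚ → Set
IsPiN H n x =
  (∃ λ G → Admissible H n G × h G ≡ x) ×
  (∀ G → Admissible H n G → h G ℚ.≤ x)

-- π(H) = lim π_n(H) = c
PiEq : Hypergraph → ℚ → Set
PiEq H c = ∀ (ε : ℚ) → 0ℚ ℚ.< ε →
  ∃ λ N → ∀ n → N ℕ.≤ n → ∃ λ x → IsPiN H n x × ℚ.∣ x ℚ.- c ∣ ℚ.< ε

_∈L_ : ∀ {n} → Subset n → List (Subset n) → Bool
F ∈L L = any (λ E → does (≡-dec BP._≟_ F E)) L

-- the closed path on m = suc n vertices x₀ … xₙ:
-- 1-edges {x₀}, {xₙ}; 2-edges {xᵢ, xᵢ₊₁}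

twoEdges : (n : ℕ) → List (Subset (suc n))
twoEdges zero = []
twoEdges (suc n) = (⁅ zero ⁆ ∪ ⁅ suc zero ⁆) ∷ map (false ∷_) (twoEdges n)

closedPath : (m : ℕ) → Hypergraph
closedPath zero = hg zero (λ _ → false)
closedPath (suc n) =
  hg (suc n) (λ F → F ∈L (⁅ zero ⁆ ∷ ⁅ fromℕ n ⁆ ∷ twoEdges n))

RIs12 : Hypergraph → Set
RIs12 H = (∀ F → IsEdge H F → ∣ F ∣ ≡ 1 ⊎ ∣ F ∣ ≡ 2)
        × (∃ λ F → IsEdge H F × ∣ F ∣ ≡ 1)
        × (∃ λ F → IsEdge H F × ∣ F ∣ ≡ 2)

TwoGraphBipartite : Hypergraph → Set
TwoGraphBipartite H =
  ∃ λ (c : Fin (size H) → Bool) →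
    ∀ F → IsEdge H F → ∣ F ∣ ≡ 2 →
      ∀ i j → i ∈ F → j ∈ F → i ≢ j → c i ≢ c j

module Submission where

-- The hypergraph of all singletons has h_n = 1 and cannot contain H, which has a 2-edge,
-- so π_n(H) ≥ 1. Conversely, a path of odd length in the 2-graph of H between two vertices
-- carrying 1-edges would close up to a forbidden P̄_2k, so after recolouring components of the
-- bipartite 2-graph all 1-vertices of H share a colour. Hence H embeds into every G with t = v(H)
-- distinct 1-vertices all adjacent to t further distinct vertices, and for H-free G a
-- Kővári–Sós–Turán count shows that the number D of pairs (x, y) with {x} and {x, y} edges is
-- o(n²). Each ordered adjacent pair of G starts or ends at a 1-vertex or starts at one of the b
-- vertices without a 1-edge, so 2e₂ ≤ 2D + nb, and with a + b = n this gives
-- h_n(G) = a/n + e₂/C(n,2) ≤ 1 + (b + 2D)/(n(n-1)) = 1 + o(1).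

open import Defs
open import Data.Nat
open import Data.Nat.Properties
open import Data.Nat.DivMod using (m≡m%n+[m/n]*n; m%n<n; m/n*n≤m)
open import Data.Nat.Combinatorics using (_C_; nC1≡n; nCk+nC[k+1]≡[n+1]C[k+1])
open import Data.Nat.ListAction.Properties using (sum-++)
open import Data.Nat.Tactic.RingSolver using (solve-∀)
open import Algebra.Bundles using (CommutativeMonoid)
open import Algebra.Properties.CommutativeSemigroup +-commutativeSemigroup
  using () renaming (interchange to +-interchange)
open import Algebra.Properties.Semiring.Sum +-*-semiring
  using (sum; sum-syntax; ∑-distrib-+; ∑-comm; sum-cong-≗; *-distribˡ-sum)
open import Data.Bool using (Bool; true; false; _∧_; _∨_; not; _xor_; if_then_else_; T)
import Data.Bool.Properties as Bool
open import Data.Fin as Fin using (Fin; zero; suc; fromℕ; inject₁)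
import Data.Fin.Properties as Fin
open import Data.Fin.Subset using (Subset; ⁅_⁆; _∪_; ∣_∣; _∈_; ⊥)
open import Data.Fin.Subset.Properties
  using (∪-identityˡ; ∪-identityʳ; ∪-idem; ∪-comm; ∪-commutativeMonoid; x∈⁅x⁆; ∣⁅x⁆∣≡1; x∈p∪q⁺; anySubset?)
open import Data.Vec as Vec using (Vec; []; _∷_; lookup; tabulate)
open import Data.Vec.Properties using (≡-dec; lookup∘tabulate)
open import Data.List as List using (List; []; _∷_; map; _++_; foldr; filter; cartesianProductWith)
open import Data.List.Properties using (map-++; map-∘; map-cong)
import Data.List.Membership.Propositional as List
open import Data.List.Membership.Propositional.Properties using (∈-map⁻; ∈-cartesianProductWith⁺; ∈-filter⁺)
open import Data.List.Relation.Unary.Any using (Any; here; there)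
import Data.List.Relation.Unary.All as All
open import Data.List.Relation.Unary.All.Properties using (all-filter)
open import Data.Integer as ℤ using (+≤+; +<+)
import Data.Integer.Properties as ℤ
open import Data.Rational as ℚ using (ℚ; mkℚ; 0ℚ; 1ℚ; toℚᵘ)
import Data.Rational.Properties as ℚ
open import Data.Rational.Unnormalised as ℚᵘ using (mkℚᵘ; *≡*; *≤*; *<*)
import Data.Rational.Unnormalised.Properties as ℚᵘ
open import Relation.Binary.Bundles using (DecTotalOrder)
import Data.List.Extrema (DecTotalOrder.totalOrder ℚ.≤-decTotalOrder) as Extrema
open import Data.Product using (∃; ∃₂; _×_; _,_; proj₁; proj₂)
open import Data.Sum using (_⊎_; inj₁; inj₂)
open import Function using (_∘_; mk⇔)
open import Function.Definitions using (Injective)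
open import Relation.Binary.PropositionalEquality
open import Relation.Nullary using (¬_; Dec; yes; no; does; contradiction; ofʸ; ofⁿ)
open import Relation.Nullary.Decidable
  using (dec-true; dec-false; does-⇔; map′; decidable-stable; _×-dec_; _⊎-dec_; _→-dec_; ¬?)

𝟙 : Bool → ℕ
𝟙 true  = 1
𝟙 false = 0

𝟙≤1 : ∀ b → 𝟙 b ≤ 1
𝟙≤1 true  = ≤-refl
𝟙≤1 false = z≤n

𝟙-∧ : ∀ a b → 𝟙 (a ∧ b) ≡ 𝟙 a * 𝟙 b
𝟙-∧ true  b = sym (+-identityʳ (𝟙 b))
𝟙-∧ false b = refl

𝟙-∨ : ∀ a b → 𝟙 (a ∨ b) ≤ 𝟙 a + 𝟙 b
𝟙-∨ true  b = s≤s z≤n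
𝟙-∨ false b = ≤-refl

𝟙-not : ∀ a → 𝟙 a + 𝟙 (not a) ≡ 1
𝟙-not true  = refl
𝟙-not false = refl

∧≡true⁻ : ∀ {a b} → (a ∧ b) ≡ true → a ≡ true × b ≡ true
∧≡true⁻ {true} {true} _ = refl , refl

∧≡true⁺ : ∀ {a b} → a ≡ true → b ≡ true → (a ∧ b) ≡ true
∧≡true⁺ refl refl = refl

∨≡true⁻ : ∀ {a b} → (a ∨ b) ≡ true → a ≡ true ⊎ b ≡ true
∨≡true⁻ {true}  _ = inj₁ refl
∨≡true⁻ {false} b = inj₂ b

does≡true⇒ : ∀ {a} {A : Set a} (a? : Dec A) → does a? ≡ true → A
does≡true⇒ (yes a) _ = a

sum-mono-≤ : ∀ {n} {f g : Fin n → ℕ} → (∀ i → f i ≤ g i) → sum f ≤ sum g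
sum-mono-≤ {zero}  f≤g = z≤n
sum-mono-≤ {suc n} f≤g = +-mono-≤ (f≤g zero) (sum-mono-≤ (f≤g ∘ suc))

sum-const : ∀ n c → ∑[ i < n ] c ≡ n * c
sum-const zero    c = refl
sum-const (suc n) c = cong (c +_) (sum-const n c)

sum-𝟙≤n : ∀ {n} (p : Fin n → Bool) → ∑[ i < n ] 𝟙 (p i) ≤ n
sum-𝟙≤n {n} p = ≤-trans (sum-mono-≤ (𝟙≤1 ∘ p)) (≤-reflexive (trans (sum-const n 1) (*-identityʳ n)))

sum-<⇒∃-< : ∀ {n} (f g : Fin n → ℕ) → sum f < sum g → ∃ λ i → f i < g i
sum-<⇒∃-< {suc n} f g lt with f zero <? g zero
... | yes f₀<g₀ = zero , f₀<g₀
... | no  f₀≮g₀ with sum-<⇒∃-< (f ∘ suc) (g ∘ suc)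
                       (+-cancelˡ-< (g zero) _ _ (≤-<-trans (+-monoˡ-≤ _ (≮⇒≥ f₀≮g₀)) lt))
...   | i , fᵢ<gᵢ = suc i , fᵢ<gᵢ

∑-tuples : ∀ {n} t → (Vec (Fin n) t → ℕ) → ℕ
∑-tuples zero    F = F []
∑-tuples (suc t) F = ∑[ x < _ ] ∑-tuples t (λ s → F (x ∷ s))

module _ {n : ℕ} where

  ∑-tuples-mono-≤ : ∀ t {F G : Vec (Fin n) t → ℕ} → (∀ s → F s ≤ G s) → ∑-tuples t F ≤ ∑-tuples t G
  ∑-tuples-mono-≤ zero    F≤G = F≤G []
  ∑-tuples-mono-≤ (suc t) F≤G = sum-mono-≤ (λ x → ∑-tuples-mono-≤ t (λ s → F≤G (x ∷ s)))

  ∑-tuples-cong : ∀ t {F G : Vec (Fin n) t → ℕ} → (∀ s → F s ≡ G s) → ∑-tuples t F ≡ ∑-tuples t G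
  ∑-tuples-cong zero    F≗G = F≗G []
  ∑-tuples-cong (suc t) F≗G = sum-cong-≗ {n} (λ x → ∑-tuples-cong t (λ s → F≗G (x ∷ s)))

  ∑-tuples-distrib-+ : ∀ t (F G : Vec (Fin n) t → ℕ) →
                       ∑-tuples t (λ s → F s + G s) ≡ ∑-tuples t F + ∑-tuples t G
  ∑-tuples-distrib-+ zero    F G = refl
  ∑-tuples-distrib-+ (suc t) F G =
    trans (sum-cong-≗ {n} (λ x → ∑-tuples-distrib-+ t (λ s → F (x ∷ s)) (λ s → G (x ∷ s))))
          (∑-distrib-+ (λ x → ∑-tuples t (λ s → F (x ∷ s))) (λ x → ∑-tuples t (λ s → G (x ∷ s))))

  ∑-tuples-const : ∀ t c → ∑-tuples {n} t (λ _ → c) ≡ n ^ t * c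
  ∑-tuples-const zero    c = sym (+-identityʳ c)
  ∑-tuples-const (suc t) c = begin
    ∑[ x < n ] ∑-tuples {n} t (λ _ → c) ≡⟨ sum-cong-≗ {n} (λ _ → ∑-tuples-const t c) ⟩
    ∑[ x < n ] (n ^ t * c)              ≡⟨ sum-const n _ ⟩
    n * (n ^ t * c)                     ≡⟨ *-assoc n (n ^ t) c ⟨
    n ^ suc t * c                       ∎
    where open ≡-Reasoning

  *-distribˡ-∑-tuples : ∀ t c (F : Vec (Fin n) t → ℕ) → c * ∑-tuples t F ≡ ∑-tuples t (λ s → c * F s)
  *-distribˡ-∑-tuples zero    c F = refl
  *-distribˡ-∑-tuples (suc t) c F =
    trans (*-distribˡ-sum c (λ x → ∑-tuples t (λ s → F (x ∷ s))))
          (sum-cong-≗ {n} (λ x → *-distribˡ-∑-tuples t c (λ s → F (x ∷ s))))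

  ∑-∑-tuples-comm : ∀ {m} t (F : Fin m → Vec (Fin n) t → ℕ) →
                    ∑[ y < m ] ∑-tuples t (F y) ≡ ∑-tuples t (λ s → ∑[ y < m ] F y s)
  ∑-∑-tuples-comm zero    F = refl
  ∑-∑-tuples-comm (suc t) F =
    trans (∑-comm (λ y x → ∑-tuples t (λ s → F y (x ∷ s))))
          (sum-cong-≗ {n} (λ x → ∑-∑-tuples-comm t (λ y s → F y (x ∷ s))))

  ∑-tuples-<⇒∃-< : ∀ t (F G : Vec (Fin n) t → ℕ) → ∑-tuples t F < ∑-tuples t G → ∃ λ s → F s < G s
  ∑-tuples-<⇒∃-< zero    F G lt = [] , lt
  ∑-tuples-<⇒∃-< (suc t) F G lt with sum-<⇒∃-< _ _ lt
  ... | x , lt′ with ∑-tuples-<⇒∃-< t _ _ lt′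
  ...   | s , Fs<Gs = x ∷ s , Fs<Gs

infix 4 _==_ _∈ᵇ_

_==_ : ∀ {n} → Fin n → Fin n → Bool
x == y = does (x Fin.≟ y)

==-refl : ∀ {n} (x : Fin n) → (x == x) ≡ true
==-refl x = dec-true (x Fin.≟ x) refl

==⇒≡ : ∀ {n} (x y : Fin n) → (x == y) ≡ true → x ≡ y
==⇒≡ x y = does≡true⇒ (x Fin.≟ y)

≢⇒==false : ∀ {n} {x y : Fin n} → x ≢ y → (x == y) ≡ false
≢⇒==false {x = x} {y} = dec-false (x Fin.≟ y)

==-sym : ∀ {n} (x y : Fin n) → (x == y) ≡ (y == x)
==-sym x y = does-⇔ (mk⇔ sym sym) (x Fin.≟ y) (y Fin.≟ x)

==-suc : ∀ {n} (x y : Fin n) → (suc x == suc y) ≡ (x == y)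
==-suc x y = does-⇔ (mk⇔ Fin.suc-injective (cong suc)) (suc x Fin.≟ suc y) (x Fin.≟ y)

sum-𝟙-== : ∀ {n} (y : Fin n) → ∑[ x < n ] 𝟙 (x == y) ≡ 1
sum-𝟙-== {suc n} zero    = cong suc (trans (sum-const n 0) (*-zeroʳ n))
sum-𝟙-== {suc n} (suc y) = trans (sum-cong-≗ {n} (λ x → cong 𝟙 (==-suc x y))) (sum-𝟙-== y)

allᵇ : ∀ {n t} → (Fin n → Bool) → Vec (Fin n) t → Bool
allᵇ P []      = true
allᵇ P (x ∷ s) = P x ∧ allᵇ P s

_∈ᵇ_ : ∀ {n t} → Fin n → Vec (Fin n) t → Bool
x ∈ᵇ []      = false
x ∈ᵇ (y ∷ s) = (x == y) ∨ (x ∈ᵇ s)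

distinct : ∀ {n t} → Vec (Fin n) t → Bool
distinct []      = true
distinct (x ∷ s) = not (x ∈ᵇ s) ∧ distinct s

module _ {n : ℕ} where

  sum-𝟙-∈ᵇ≤length : ∀ {t} (s : Vec (Fin n) t) → ∑[ x < n ] 𝟙 (x ∈ᵇ s) ≤ t
  sum-𝟙-∈ᵇ≤length []      = ≤-reflexive (trans (sum-const n 0) (*-zeroʳ n))
  sum-𝟙-∈ᵇ≤length (y ∷ s) = begin
    ∑[ x < n ] 𝟙 ((x == y) ∨ (x ∈ᵇ s))             ≤⟨ sum-mono-≤ (λ x → 𝟙-∨ (x == y) (x ∈ᵇ s)) ⟩
    ∑[ x < n ] (𝟙 (x == y) + 𝟙 (x ∈ᵇ s))           ≡⟨ ∑-distrib-+ (λ x → 𝟙 (x == y)) (λ x → 𝟙 (x ∈ᵇ s)) ⟩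
    ∑[ x < n ] 𝟙 (x == y) + ∑[ x < n ] 𝟙 (x ∈ᵇ s) ≤⟨ +-mono-≤ (≤-reflexive (sum-𝟙-== y)) (sum-𝟙-∈ᵇ≤length s) ⟩
    suc _                                          ∎
    where open ≤-Reasoning

  ∑-tuples-allᵇ : ∀ t (P : Fin n → Bool) →
                  ∑-tuples t (λ s → 𝟙 (allᵇ P s)) ≡ (∑[ x < n ] 𝟙 (P x)) ^ t
  ∑-tuples-allᵇ zero    P = refl
  ∑-tuples-allᵇ (suc t) P = begin
    ∑[ x < n ] ∑-tuples t (λ s → 𝟙 (P x ∧ allᵇ P s))
      ≡⟨ sum-cong-≗ {n} (λ x → ∑-tuples-cong t (λ s → 𝟙-∧ (P x) (allᵇ P s))) ⟩
    ∑[ x < n ] ∑-tuples t (λ s → 𝟙 (P x) * 𝟙 (allᵇ P s))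
      ≡⟨ sum-cong-≗ {n} (λ x → *-distribˡ-∑-tuples t (𝟙 (P x)) (λ s → 𝟙 (allᵇ P s))) ⟨
    ∑[ x < n ] (𝟙 (P x) * ∑-tuples t (λ s → 𝟙 (allᵇ P s)))
      ≡⟨ sum-cong-≗ {n} (λ x → cong (𝟙 (P x) *_) (∑-tuples-allᵇ t P)) ⟩
    ∑[ x < n ] (𝟙 (P x) * N ^ t)
      ≡⟨ sum-cong-≗ {n} (λ x → *-comm (𝟙 (P x)) (N ^ t)) ⟩
    ∑[ x < n ] (N ^ t * 𝟙 (P x))
      ≡⟨ *-distribˡ-sum (N ^ t) (λ x → 𝟙 (P x)) ⟨
    N ^ t * N
      ≡⟨ *-comm (N ^ t) N ⟩
    N ^ suc t ∎
    where
    open ≡-Reasoning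
    N = ∑[ x < n ] 𝟙 (P x)

  nonDistinct-tuples : ∀ t → n * ∑-tuples t (λ s → 𝟙 (not (distinct s))) ≤ t * t * n ^ t
  nonDistinct-tuples zero    = ≤-reflexive (*-zeroʳ n)
  nonDistinct-tuples (suc t) = begin
    n * ∑[ x < n ] ∑-tuples t (λ s → 𝟙 (not (not (x ∈ᵇ s) ∧ distinct s)))
      ≤⟨ *-monoʳ-≤ n (sum-mono-≤ {n} (λ x → ∑-tuples-mono-≤ t (λ s → repeated (x ∈ᵇ s) (distinct s)))) ⟩
    n * ∑[ x < n ] ∑-tuples t (λ s → 𝟙 (x ∈ᵇ s) + 𝟙 (not (distinct s)))
      ≡⟨ cong (n *_) (sum-cong-≗ {n} (λ x → ∑-tuples-distrib-+ t (λ s → 𝟙 (x ∈ᵇ s)) (λ s → 𝟙 (not (distinct s))))) ⟩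
    n * ∑[ x < n ] (∑-tuples t (λ s → 𝟙 (x ∈ᵇ s)) + R)
      ≡⟨ cong (n *_) (∑-distrib-+ (λ x → ∑-tuples t (λ s → 𝟙 (x ∈ᵇ s))) (λ (_ : Fin n) → R)) ⟩
    n * (∑[ x < n ] ∑-tuples t (λ s → 𝟙 (x ∈ᵇ s)) + ∑[ x < n ] R)
      ≡⟨ cong₂ (λ a b → n * (a + b)) (∑-∑-tuples-comm t (λ x s → 𝟙 (x ∈ᵇ s))) (sum-const n R) ⟩
    n * (∑-tuples t (λ s → ∑[ x < n ] 𝟙 (x ∈ᵇ s)) + n * R)
      ≤⟨ *-monoʳ-≤ n (+-monoˡ-≤ (n * R) (∑-tuples-mono-≤ t sum-𝟙-∈ᵇ≤length)) ⟩
    n * (∑-tuples {n} t (λ _ → t) + n * R)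
      ≡⟨ cong (λ a → n * (a + n * R)) (∑-tuples-const t t) ⟩
    n * (n ^ t * t + n * R)
      ≤⟨ *-monoʳ-≤ n (+-monoʳ-≤ (n ^ t * t) (nonDistinct-tuples t)) ⟩
    n * (n ^ t * t + t * t * n ^ t)
      ≤⟨ ≤-reflexive (expand n t (n ^ t)) ⟩
    (t * t + t) * (n * n ^ t)
      ≤⟨ *-monoˡ-≤ (n * n ^ t) (+-monoʳ-≤ (t * t) (m≤m+n t _)) ⟩
    (t * t + (t + suc t)) * (n * n ^ t)
      ≡⟨ cong (_* (n * n ^ t)) (square-suc t) ⟩
    suc t * suc t * n ^ suc t ∎
    where
    open ≤-Reasoning
    R = ∑-tuples t (λ s → 𝟙 (not (distinct s)))
    repeated : ∀ a b → 𝟙 (not (not a ∧ b)) ≤ 𝟙 a + 𝟙 (not b)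
    repeated true  b     = s≤s z≤n
    repeated false true  = z≤n
    repeated false false = ≤-refl
    expand : ∀ n t p → n * (p * t + t * t * p) ≡ (t * t + t) * (n * p)
    expand = solve-∀
    square-suc : ∀ t → t * t + (t + suc t) ≡ suc t * suc t
    square-suc = solve-∀

module _ {n : ℕ} where

  lookup-∈ᵇ : ∀ {t} (s : Vec (Fin n) t) i → (lookup s i ∈ᵇ s) ≡ true
  lookup-∈ᵇ (x ∷ s) zero    = cong (_∨ (x ∈ᵇ s)) (==-refl x)
  lookup-∈ᵇ (x ∷ s) (suc i) with lookup s i == x
  ... | true  = refl
  ... | false = lookup-∈ᵇ s i

  distinct⇒lookup-injective : ∀ {t} (s : Vec (Fin n) t) → distinct s ≡ true → Injective _≡_ _≡_ (lookup s)
  distinct⇒lookup-injective (x ∷ s) d {zero}  {zero}  _ = refl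
  distinct⇒lookup-injective (x ∷ s) d {suc i} {suc j} e =
    cong suc (distinct⇒lookup-injective s (proj₂ (∧≡true⁻ d)) e)
  distinct⇒lookup-injective (x ∷ s) d {zero}  {suc j} e =
    contradiction (subst (λ z → (z ∈ᵇ s) ≡ true) (sym e) (lookup-∈ᵇ s j)) (not-head (x ∈ᵇ s) d)
    where not-head : ∀ a {b} → (not a ∧ b) ≡ true → a ≢ true
          not-head true  () refl
  distinct⇒lookup-injective (x ∷ s) d {suc i} {zero}  e =
    sym (distinct⇒lookup-injective (x ∷ s) d {zero} {suc i} (sym e))

  distinct⇒length≤ : ∀ {t} (s : Vec (Fin n) t) → distinct s ≡ true → t ≤ n
  distinct⇒length≤ s d = ≮⇒≥ λ n<t →
    let i , j , i<j , eq = Fin.pigeonhole n<t (lookup s)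
    in Fin.<⇒≢ i<j (distinct⇒lookup-injective s d eq)

  allᵇ⇒lookup : ∀ {t} (Q : Fin n → Bool) (s : Vec (Fin n) t) → allᵇ Q s ≡ true →
                ∀ i → Q (lookup s i) ≡ true
  allᵇ⇒lookup Q (x ∷ s) a zero    = proj₁ (∧≡true⁻ a)
  allᵇ⇒lookup Q (x ∷ s) a (suc i) = allᵇ⇒lookup Q s (proj₂ (∧≡true⁻ a)) i

  zero∉map-suc : ∀ {t} (s : Vec (Fin n) t) → (zero ∈ᵇ Vec.map suc s) ≡ false
  zero∉map-suc []      = refl
  zero∉map-suc (x ∷ s) = zero∉map-suc s

  suc∈ᵇmap-suc : ∀ {t} (x : Fin n) (s : Vec (Fin n) t) → (suc x ∈ᵇ Vec.map suc s) ≡ (x ∈ᵇ s)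
  suc∈ᵇmap-suc x []      = refl
  suc∈ᵇmap-suc x (y ∷ s) = cong₂ _∨_ (==-suc x y) (suc∈ᵇmap-suc x s)

  distinct-map-suc : ∀ {t} (s : Vec (Fin n) t) → distinct (Vec.map suc s) ≡ distinct s
  distinct-map-suc []      = refl
  distinct-map-suc (x ∷ s) = cong₂ (λ a b → not a ∧ b) (suc∈ᵇmap-suc x s) (distinct-map-suc s)

  allᵇ-map-suc : ∀ {t} (Q : Fin (suc n) → Bool) (s : Vec (Fin n) t) →
                 allᵇ Q (Vec.map suc s) ≡ allᵇ (Q ∘ suc) s
  allᵇ-map-suc Q []      = refl
  allᵇ-map-suc Q (x ∷ s) = cong (Q (suc x) ∧_) (allᵇ-map-suc Q s)

choose-distinct : ∀ {n} t (Q : Fin n → Bool) → t ≤ ∑[ y < n ] 𝟙 (Q y) →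
                  ∃ λ (τ : Vec (Fin n) t) → distinct τ ≡ true × allᵇ Q τ ≡ true
choose-distinct         zero    Q _ = [] , refl , refl
choose-distinct {suc n} (suc t) Q t<∑ with Q zero in Q₀
... | false with choose-distinct (suc t) (Q ∘ suc) t<∑
...   | τ , d , a = Vec.map suc τ , trans (distinct-map-suc τ) d , trans (allᵇ-map-suc Q τ) a
choose-distinct {suc n} (suc t) Q (s≤s t≤∑) | true with choose-distinct t (Q ∘ suc) t≤∑
...   | τ , d , a = zero ∷ Vec.map suc τ
                  , cong₂ (λ u v → not u ∧ v) (zero∉map-suc τ) (trans (distinct-map-suc τ) d)
                  , cong₂ _∧_ Q₀ (trans (allᵇ-map-suc Q τ) a)

-- The Kővári–Sós–Turán count

-- ∑_y deg(y)^t counts the pairs (y, s) with s a t-tuple of neighbours of y, so many edges force a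
-- repetition-free t-tuple with t distinct common neighbours.
module KővariSósTurán {n : ℕ} .{{_ : NonZero n}} (t : ℕ) (adj : Fin n → Fin n → Bool) where

  deg : Fin n → ℕ
  deg y = ∑[ x < n ] 𝟙 (adj y x)

  commonNeighbours : Vec (Fin n) t → ℕ
  commonNeighbours s = ∑[ y < n ] 𝟙 (allᵇ (adj y) s)

  highDegree : ℕ → ℕ
  highDegree m = ∑[ y < n ] 𝟙 (m ≤ᵇ deg y)

  ∑-deg^t≡∑-commonNeighbours : ∑[ y < n ] (deg y ^ t) ≡ ∑-tuples t commonNeighbours
  ∑-deg^t≡∑-commonNeighbours =
    trans (sum-cong-≗ {n} (λ y → sym (∑-tuples-allᵇ t (adj y))))
          (∑-∑-tuples-comm t (λ y s → 𝟙 (allᵇ (adj y) s)))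

  deg≤ : ∀ m y → deg y ≤ n * 𝟙 (m ≤ᵇ deg y) + m
  deg≤ m y with m ≤ᵇ deg y | ≤ᵇ-reflects-≤ m (deg y)
  ... | true  | _        = ≤-trans (sum-𝟙≤n (adj y)) (≤-trans (≤-reflexive (sym (*-identityʳ n))) (m≤m+n _ m))
  ... | false | ofⁿ m≰d = ≤-trans (<⇒≤ (≰⇒> m≰d)) (m≤n+m m _)

  m^t≤deg^t : ∀ m y → 𝟙 (m ≤ᵇ deg y) * m ^ t ≤ deg y ^ t
  m^t≤deg^t m y with m ≤ᵇ deg y | ≤ᵇ-reflects-≤ m (deg y)
  ... | true  | ofʸ m≤d = ≤-trans (≤-reflexive (+-identityʳ _)) (^-monoˡ-≤ t m≤d)
  ... | false | _       = z≤n

  m≤highDegree : ∀ m → m * n + m * n ≤ sum deg → m ≤ highDegree m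
  m≤highDegree m 2mn≤∑deg = *-cancelʳ-≤ m (highDegree m) n (+-cancelʳ-≤ (m * n) (m * n) _ (begin
    m * n + m * n                                   ≤⟨ 2mn≤∑deg ⟩
    sum deg                                         ≤⟨ sum-mono-≤ (deg≤ m) ⟩
    ∑[ y < n ] (n * 𝟙 (m ≤ᵇ deg y) + m)             ≡⟨ ∑-distrib-+ (λ y → n * 𝟙 (m ≤ᵇ deg y)) (λ _ → m) ⟩
    ∑[ y < n ] (n * 𝟙 (m ≤ᵇ deg y)) + ∑[ y < n ] m
      ≡⟨ cong₂ _+_ (*-distribˡ-sum n (λ y → 𝟙 (m ≤ᵇ deg y))) (sym (sum-const n m)) ⟨
    n * highDegree m + n * m                        ≡⟨ cong₂ _+_ (*-comm n _) (*-comm n m) ⟩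
    highDegree m * n + m * n                        ∎))
    where open ≤-Reasoning

  m^[1+t]≤∑-commonNeighbours : ∀ m → m * n + m * n ≤ sum deg → m ^ suc t ≤ ∑-tuples t commonNeighbours
  m^[1+t]≤∑-commonNeighbours m 2mn≤∑deg = begin
    m * m ^ t                             ≤⟨ *-monoˡ-≤ (m ^ t) (m≤highDegree m 2mn≤∑deg) ⟩
    highDegree m * m ^ t                  ≡⟨ *-comm (highDegree m) (m ^ t) ⟩
    m ^ t * highDegree m                  ≡⟨ *-distribˡ-sum (m ^ t) (λ y → 𝟙 (m ≤ᵇ deg y)) ⟩
    ∑[ y < n ] (m ^ t * 𝟙 (m ≤ᵇ deg y))   ≡⟨ sum-cong-≗ {n} (λ y → *-comm (m ^ t) _) ⟩
    ∑[ y < n ] (𝟙 (m ≤ᵇ deg y) * m ^ t)   ≤⟨ sum-mono-≤ (m^t≤deg^t m) ⟩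
    ∑[ y < n ] (deg y ^ t)                ≡⟨ ∑-deg^t≡∑-commonNeighbours ⟩
    ∑-tuples t commonNeighbours           ∎
    where open ≤-Reasoning

  -- A tuple beats this weight only if it is repetition-free and has ≥ t common neighbours.
  weight : Vec (Fin n) t → ℕ
  weight s = pred t + n * 𝟙 (not (distinct s))

  n*∑-weight≤ : n * ∑-tuples t weight ≤ (t + t * t) * n ^ t * n
  n*∑-weight≤ = begin
    n * ∑-tuples t weight
      ≡⟨ cong (n *_) (∑-tuples-distrib-+ t (λ _ → pred t) (λ s → n * 𝟙 (not (distinct s)))) ⟩
    n * (∑-tuples t (λ _ → pred t) + ∑-tuples t (λ s → n * 𝟙 (not (distinct s))))
      ≡⟨ cong₂ (λ a b → n * (a + b)) (∑-tuples-const {n} t (pred t))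
                                    (sym (*-distribˡ-∑-tuples t n (λ s → 𝟙 (not (distinct s))))) ⟩
    n * (n ^ t * pred t + n * ∑-tuples t (λ s → 𝟙 (not (distinct s))))
      ≤⟨ *-monoʳ-≤ n (+-mono-≤ (*-monoʳ-≤ (n ^ t) pred[n]≤n) (nonDistinct-tuples t)) ⟩
    n * (n ^ t * t + t * t * n ^ t)
      ≡⟨ rearrange n t (n ^ t) ⟩
    (t + t * t) * n ^ t * n ∎
    where
    open ≤-Reasoning
    rearrange : ∀ n t p → n * (p * t + t * t * p) ≡ (t + t * t) * p * n
    rearrange = solve-∀

  rich-tuple : ∀ s → pred t + n * 𝟙 (not (distinct s)) < commonNeighbours s →
               distinct s ≡ true × t ≤ commonNeighbours s
  rich-tuple s w<c with distinct s
  ... | true  = refl , pred<⇒≤ t (subst (_< commonNeighbours s) weight≡pred w<c)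
    where
    weight≡pred : pred t + n * 0 ≡ pred t
    weight≡pred = trans (cong (pred t +_) (*-zeroʳ n)) (+-identityʳ _)
    pred<⇒≤ : ∀ t {c} → pred t < c → t ≤ c
    pred<⇒≤ zero    _  = z≤n
    pred<⇒≤ (suc t) lt = lt
  ... | false = contradiction w<c (≤⇒≯ (begin
    commonNeighbours s ≤⟨ sum-𝟙≤n (λ y → allᵇ (adj y) s) ⟩
    n                  ≡⟨ *-identityʳ n ⟨
    n * 1              ≤⟨ m≤n+m (n * 1) (pred t) ⟩
    pred t + n * 1     ∎))
    where open ≤-Reasoning

  ∑weight<∑commonNeighbours : ∀ m → m * n + m * n ≤ sum deg → (t + t * t) * n ^ t < m ^ suc t →
                              ∑-tuples t weight < ∑-tuples t commonNeighbours
  ∑weight<∑commonNeighbours m 2mn≤∑deg t-small = *-cancelˡ-< n _ _ (begin-strict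
    n * ∑-tuples t weight              ≤⟨ n*∑-weight≤ ⟩
    (t + t * t) * n ^ t * n            <⟨ *-monoˡ-< n t-small ⟩
    m ^ suc t * n                      ≤⟨ *-monoˡ-≤ n (m^[1+t]≤∑-commonNeighbours m 2mn≤∑deg) ⟩
    ∑-tuples t commonNeighbours * n    ≡⟨ *-comm _ n ⟩
    n * ∑-tuples t commonNeighbours    ∎)
    where open ≤-Reasoning

  K[t,t] : ∀ m → m * n + m * n ≤ sum deg → (t + t * t) * n ^ t < m ^ suc t →
           ∃₂ λ s τ → distinct s ≡ true × distinct τ ≡ true × allᵇ (λ y → allᵇ (adj y) s) τ ≡ true
  K[t,t] m 2mn≤∑deg t-small
    with s , weight<common ← ∑-tuples-<⇒∃-< t weight commonNeighbours (∑weight<∑commonNeighbours m 2mn≤∑deg t-small)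
    with distinct-s , t≤common ← rich-tuple s weight<common
    with τ , distinct-τ , all-adjacent ← choose-distinct t (λ y → allᵇ (adj y) s) t≤common
    = s , τ , distinct-s , distinct-τ , all-adjacent

  no-K[t,t]⇒∑deg< : ∀ m → (t + t * t) * n ^ t < m ^ suc t →
    (∀ s τ → distinct s ≡ true → distinct τ ≡ true → ¬ allᵇ (λ y → allᵇ (adj y) s) τ ≡ true) →
    sum deg < m * n + m * n
  no-K[t,t]⇒∑deg< m t-small no-K = ≰⇒> λ 2mn≤∑deg →
    let s , τ , ds , dτ , all = K[t,t] m 2mn≤∑deg t-small in no-K s τ ds dτ all

module _ {b : ℕ} where

  open import Algebra.Properties.CommutativeSemigroup
    (CommutativeMonoid.commutativeSemigroup (∪-commutativeMonoid b)) using (interchange)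

  image-⊥ : ∀ {a} (f : Fin a → Fin b) → image f ⊥ ≡ ⊥
  image-⊥ {zero}  f = refl
  image-⊥ {suc a} f = trans (∪-identityˡ _) (image-⊥ (f ∘ suc))

  image-⁅⁆ : ∀ {a} (f : Fin a → Fin b) x → image f ⁅ x ⁆ ≡ ⁅ f x ⁆
  image-⁅⁆ {suc a} f zero    = trans (cong (⁅ f zero ⁆ ∪_) (image-⊥ (f ∘ suc))) (∪-identityʳ _)
  image-⁅⁆ {suc a} f (suc x) = trans (∪-identityˡ _) (image-⁅⁆ (f ∘ suc) x)

  image-∪ : ∀ {a} (f : Fin a → Fin b) (X Y : Subset a) → image f (X ∪ Y) ≡ image f X ∪ image f Y
  image-∪ {zero}  f []      []      = sym (∪-idem ⊥)
  image-∪ {suc a} f (x ∷ X) (y ∷ Y) =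
    trans (cong₂ _∪_ (if-∪ x y) (image-∪ (f ∘ suc) X Y)) (interchange _ _ _ _)
    where
    if-∪ : ∀ x y → (if x ∨ y then ⁅ f zero ⁆ else ⊥)
                 ≡ (if x then ⁅ f zero ⁆ else ⊥) ∪ (if y then ⁅ f zero ⁆ else ⊥)
    if-∪ true  true  = sym (∪-idem _)
    if-∪ true  false = sym (∪-identityʳ _)
    if-∪ false true  = sym (∪-identityˡ _)
    if-∪ false false = sym (∪-idem ⊥)

  image-pair : ∀ {a} (f : Fin a → Fin b) x y → image f (⁅ x ⁆ ∪ ⁅ y ⁆) ≡ ⁅ f x ⁆ ∪ ⁅ f y ⁆
  image-pair f x y = trans (image-∪ f ⁅ x ⁆ ⁅ y ⁆) (cong₂ _∪_ (image-⁅⁆ f x) (image-⁅⁆ f y))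

∣p∣≡0⇒p≡⊥ : ∀ {n} (p : Subset n) → ∣ p ∣ ≡ 0 → p ≡ ⊥
∣p∣≡0⇒p≡⊥ []          _  = refl
∣p∣≡0⇒p≡⊥ (false ∷ p) eq = cong (false ∷_) (∣p∣≡0⇒p≡⊥ p eq)

∣p∣≡1⇒p≡⁅x⁆ : ∀ {n} (p : Subset n) → ∣ p ∣ ≡ 1 → ∃ λ x → p ≡ ⁅ x ⁆
∣p∣≡1⇒p≡⁅x⁆ (true  ∷ p) eq = zero , cong (true ∷_) (∣p∣≡0⇒p≡⊥ p (suc-injective eq))
∣p∣≡1⇒p≡⁅x⁆ (false ∷ p) eq with ∣p∣≡1⇒p≡⁅x⁆ p eq
... | x , refl = suc x , refl

∣p∣≡2⇒p≡pair : ∀ {n} (p : Subset n) → ∣ p ∣ ≡ 2 → ∃₂ λ x y → x ≢ y × p ≡ ⁅ x ⁆ ∪ ⁅ y ⁆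
∣p∣≡2⇒p≡pair (true  ∷ p) eq with ∣p∣≡1⇒p≡⁅x⁆ p (suc-injective eq)
... | y , refl = zero , suc y , (λ ()) , cong (true ∷_) (sym (∪-identityˡ _))
∣p∣≡2⇒p≡pair (false ∷ p) eq with ∣p∣≡2⇒p≡pair p eq
... | x , y , x≢y , refl = suc x , suc y , x≢y ∘ Fin.suc-injective , refl

∣pair∣≡2 : ∀ {n} {x y : Fin n} → x ≢ y → ∣ ⁅ x ⁆ ∪ ⁅ y ⁆ ∣ ≡ 2
∣pair∣≡2 {x = zero}  {zero}  x≢y = contradiction refl x≢y
∣pair∣≡2 {x = zero}  {suc y} _   = cong suc (trans (cong ∣_∣ (∪-identityˡ ⁅ y ⁆)) (∣⁅x⁆∣≡1 y))
∣pair∣≡2 {x = suc x} {zero}  _   = cong suc (trans (cong ∣_∣ (∪-identityʳ ⁅ x ⁆)) (∣⁅x⁆∣≡1 x))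
∣pair∣≡2 {x = suc x} {suc y} x≢y = ∣pair∣≡2 (x≢y ∘ cong suc)

x∈pair : ∀ {n} (x y : Fin n) → x ∈ ⁅ x ⁆ ∪ ⁅ y ⁆
x∈pair x y = x∈p∪q⁺ (inj₁ (x∈⁅x⁆ x))

y∈pair : ∀ {n} (x y : Fin n) → y ∈ ⁅ x ⁆ ∪ ⁅ y ⁆
y∈pair x y = x∈p∪q⁺ (inj₂ (x∈⁅x⁆ y))

∑-subsets : ∀ n → (Subset n → ℕ) → ℕ
∑-subsets zero    g = g []
∑-subsets (suc n) g = ∑-subsets n (g ∘ (true ∷_)) + ∑-subsets n (g ∘ (false ∷_))

∑-subsets-cong : ∀ n {f g : Subset n → ℕ} → (∀ p → f p ≡ g p) → ∑-subsets n f ≡ ∑-subsets n g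
∑-subsets-cong zero    f≗g = f≗g []
∑-subsets-cong (suc n) f≗g = cong₂ _+_ (∑-subsets-cong n (f≗g ∘ (true ∷_))) (∑-subsets-cong n (f≗g ∘ (false ∷_)))

∑-subsets-0 : ∀ n → ∑-subsets n (λ _ → 0) ≡ 0
∑-subsets-0 zero    = refl
∑-subsets-0 (suc n) = cong₂ _+_ (∑-subsets-0 n) (∑-subsets-0 n)

∑-subsets-distrib-+ : ∀ n (f g : Subset n → ℕ) →
                      ∑-subsets n (λ p → f p + g p) ≡ ∑-subsets n f + ∑-subsets n g
∑-subsets-distrib-+ zero    f g = refl
∑-subsets-distrib-+ (suc n) f g =
  trans (cong₂ _+_ (∑-subsets-distrib-+ n (f ∘ (true ∷_)) (g ∘ (true ∷_)))
                   (∑-subsets-distrib-+ n (f ∘ (false ∷_)) (g ∘ (false ∷_))))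
        (+-interchange (∑-subsets n (f ∘ (true ∷_))) (∑-subsets n (g ∘ (true ∷_)))
                       (∑-subsets n (f ∘ (false ∷_))) (∑-subsets n (g ∘ (false ∷_))))

*-distribˡ-∑-subsets : ∀ n c (f : Subset n → ℕ) → c * ∑-subsets n f ≡ ∑-subsets n (λ p → c * f p)
*-distribˡ-∑-subsets zero    c f = refl
*-distribˡ-∑-subsets (suc n) c f =
  trans (*-distribˡ-+ c _ _) (cong₂ _+_ (*-distribˡ-∑-subsets n c _) (*-distribˡ-∑-subsets n c _))

∑-subsets-size0 : ∀ n (g : Subset n → ℕ) → ∑-subsets n (λ p → 𝟙 (∣ p ∣ ≡ᵇ 0) * g p) ≡ g ⊥
∑-subsets-size0 zero    g = +-identityʳ (g [])
∑-subsets-size0 (suc n) g = cong₂ _+_ (∑-subsets-0 n) (∑-subsets-size0 n (g ∘ (false ∷_)))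

∑-subsets-size1 : ∀ n (g : Subset n → ℕ) →
                  ∑-subsets n (λ p → 𝟙 (∣ p ∣ ≡ᵇ 1) * g p) ≡ ∑[ x < n ] g ⁅ x ⁆
∑-subsets-size1 zero    g = refl
∑-subsets-size1 (suc n) g =
  cong₂ _+_ (∑-subsets-size0 n (g ∘ (true ∷_))) (∑-subsets-size1 n (g ∘ (false ∷_)))

-- Each 2-subset {x, y} is counted once as (x, y) and once as (y, x).
∑-subsets-size2 : ∀ n (g : Subset n → ℕ) →
  2 * ∑-subsets n (λ p → 𝟙 (∣ p ∣ ≡ᵇ 2) * g p) ≡ ∑[ x < n ] ∑[ y < n ] (𝟙 (not (x == y)) * g (⁅ x ⁆ ∪ ⁅ y ⁆))
∑-subsets-size2 zero    g = refl
∑-subsets-size2 (suc n) g = begin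
  2 * (∑-subsets n (λ p → 𝟙 (∣ p ∣ ≡ᵇ 1) * g (true ∷ p)) + ∑-subsets n (λ p → 𝟙 (∣ p ∣ ≡ᵇ 2) * g (false ∷ p)))
    ≡⟨ *-distribˡ-+ 2 (∑-subsets n (λ p → 𝟙 (∣ p ∣ ≡ᵇ 1) * g (true ∷ p))) _ ⟩
  2 * ∑-subsets n (λ p → 𝟙 (∣ p ∣ ≡ᵇ 1) * g (true ∷ p)) + 2 * ∑-subsets n (λ p → 𝟙 (∣ p ∣ ≡ᵇ 2) * g (false ∷ p))
    ≡⟨ cong₂ (λ a b → 2 * a + b) (∑-subsets-size1 n (g ∘ (true ∷_))) (∑-subsets-size2 n (g ∘ (false ∷_))) ⟩
  2 * P₀ + Pₛₛ
    ≡⟨ double P₀ Pₛₛ ⟩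
  P₀ + (P₀ + Pₛₛ)
    ≡⟨ cong₂ (λ a b → a + (b + Pₛₛ)) (sum-cong-≗ {n} λ y → cong g (sym (∪-identityˡ _)))
                                      (sum-cong-≗ {n} λ x → cong g (sym (∪-identityʳ _))) ⟩
  ∑[ y < n ] g (⁅ zero ⁆ ∪ ⁅ suc y ⁆) + (∑[ x < n ] g (⁅ suc x ⁆ ∪ ⁅ zero ⁆) + Pₛₛ)
    ≡⟨ cong (∑[ y < n ] g (⁅ zero ⁆ ∪ ⁅ suc y ⁆) +_) (∑-distrib-+ (λ x → g (⁅ suc x ⁆ ∪ ⁅ zero ⁆)) _) ⟨
  ∑[ y < n ] g (⁅ zero ⁆ ∪ ⁅ suc y ⁆) + ∑[ x < n ] (g (⁅ suc x ⁆ ∪ ⁅ zero ⁆) + ∑[ y < n ] Gₛₛ x y)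
    ≡⟨ cong₂ _+_ (sum-cong-≗ {n} λ y → sym (+-identityʳ _))
                 (sum-cong-≗ {n} λ x → cong₂ _+_ (sym (+-identityʳ _))
                   (sum-cong-≗ {n} λ y → cong (λ b → 𝟙 (not b) * g (false ∷ (⁅ x ⁆ ∪ ⁅ y ⁆))) (sym (==-suc x y)))) ⟩
  ∑[ y < suc n ] (𝟙 (not (zero == y)) * g (⁅ zero ⁆ ∪ ⁅ y ⁆))
    + ∑[ x < n ] ∑[ y < suc n ] (𝟙 (not (suc x == y)) * g (⁅ suc x ⁆ ∪ ⁅ y ⁆)) ∎
  where
  open ≡-Reasoning
  P₀ = ∑[ y < n ] g (true ∷ ⁅ y ⁆)
  Gₛₛ : Fin n → Fin n → ℕ
  Gₛₛ x y = 𝟙 (not (x == y)) * g (false ∷ (⁅ x ⁆ ∪ ⁅ y ⁆))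
  Pₛₛ = ∑[ x < n ] ∑[ y < n ] Gₛₛ x y
  double : ∀ a b → 2 * a + b ≡ a + (a + b)
  double = solve-∀

sum-allSubsets : ∀ n (g : Subset n → ℕ) → foldr _+_ 0 (map g (allSubsets n)) ≡ ∑-subsets n g
sum-allSubsets zero    g = +-identityʳ (g [])
sum-allSubsets (suc n) g = begin
  foldr _+_ 0 (map g (map (true ∷_) (allSubsets n) ++ map (false ∷_) (allSubsets n)))
    ≡⟨ cong (foldr _+_ 0) (map-++ g (map (true ∷_) (allSubsets n)) _) ⟩
  foldr _+_ 0 (map g (map (true ∷_) (allSubsets n)) ++ map g (map (false ∷_) (allSubsets n)))
    ≡⟨ sum-++ (map g (map (true ∷_) (allSubsets n))) _ ⟩
  foldr _+_ 0 (map g (map (true ∷_) (allSubsets n))) + foldr _+_ 0 (map g (map (false ∷_) (allSubsets n)))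
    ≡⟨ cong₂ _+_ (cong (foldr _+_ 0) (map-∘ (allSubsets n))) (cong (foldr _+_ 0) (map-∘ (allSubsets n))) ⟨
  foldr _+_ 0 (map (g ∘ (true ∷_)) (allSubsets n)) + foldr _+_ 0 (map (g ∘ (false ∷_)) (allSubsets n))
    ≡⟨ cong₂ _+_ (sum-allSubsets n (g ∘ (true ∷_))) (sum-allSubsets n (g ∘ (false ∷_))) ⟩
  ∑-subsets (suc n) g ∎
  where open ≡-Reasoning

-- The 2-graph of H and its recolouring

adjacent : (G : Hypergraph) → Fin (size G) → Fin (size G) → Bool
adjacent G u v = edge G (⁅ u ⁆ ∪ ⁅ v ⁆) ∧ not (u == v)

module _ (G : Hypergraph) {u v : Fin (size G)} where

  adjacent⇒edge : adjacent G u v ≡ true → IsEdge G (⁅ u ⁆ ∪ ⁅ v ⁆)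
  adjacent⇒edge = proj₁ ∘ ∧≡true⁻

  adjacent⇒≢ : adjacent G u v ≡ true → u ≢ v
  adjacent⇒≢ a refl with () ← trans (cong not (sym (==-refl u))) (proj₂ (∧≡true⁻ a))

  adjacent-sym : adjacent G u v ≡ adjacent G v u
  adjacent-sym = cong₂ (λ F b → edge G F ∧ not b) (∪-comm ⁅ u ⁆ ⁅ v ⁆) (==-sym u v)

  edge⇒adjacent : IsEdge G (⁅ u ⁆ ∪ ⁅ v ⁆) → u ≢ v → adjacent G u v ≡ true
  edge⇒adjacent e u≢v = ∧≡true⁺ e (cong not (≢⇒==false u≢v))

bipartite⇒adjacent-colours-differ : (H : Hypergraph) (c : Fin (size H) → Bool) →
  (∀ F → IsEdge H F → ∣ F ∣ ≡ 2 → ∀ i j → i ∈ F → j ∈ F → i ≢ j → c i ≢ c j) →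
  ∀ u v → adjacent H u v ≡ true → c u ≢ c v
bipartite⇒adjacent-colours-differ H c c-proper u v a =
  c-proper _ (adjacent⇒edge H a) (∣pair∣≡2 u≢v) u v (x∈pair u v) (y∈pair u v) u≢v
  where u≢v = adjacent⇒≢ H a

∈L⇒Any : ∀ {n} {F : Subset n} (L : List (Subset n)) → (F ∈L L) ≡ true → Any (F ≡_) L
∈L⇒Any {F = F} (E ∷ L) F∈L with ∨≡true⁻ F∈L
... | inj₁ F≟E = here (does≡true⇒ (≡-dec Bool._≟_ F E) F≟E)
... | inj₂ F∈L′ = there (∈L⇒Any L F∈L′)

twoEdges-pairs : ∀ k {F} → Any (F ≡_) (twoEdges k) → ∃ λ (i : Fin k) → F ≡ ⁅ inject₁ i ⁆ ∪ ⁅ suc i ⁆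
twoEdges-pairs (suc k) (here F≡E)  = zero , F≡E
twoEdges-pairs (suc k) (there F∈L) with ∈-map⁻ (false ∷_) F∈L
... | E , E∈L , refl with twoEdges-pairs k E∈L
...   | i , refl = suc i , refl

closedPath-edges : ∀ k F → IsEdge (closedPath (suc k)) F →
  F ≡ ⁅ zero ⁆ ⊎ F ≡ ⁅ fromℕ k ⁆ ⊎ ∃ λ (i : Fin k) → F ≡ ⁅ inject₁ i ⁆ ∪ ⁅ suc i ⁆
closedPath-edges k F e with ∈L⇒Any (⁅ zero ⁆ ∷ ⁅ fromℕ k ⁆ ∷ twoEdges k) e
... | here F≡⁅0⁆          = inj₁ F≡⁅0⁆
... | there (here F≡⁅k⁆)  = inj₂ (inj₁ F≡⁅k⁆)
... | there (there F∈two) = inj₂ (inj₂ (twoEdges-pairs k F∈two))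

module Recolouring (H : Hypergraph) (c : Fin (size H) → Bool)
  (c-proper : ∀ u v → adjacent H u v ≡ true → c u ≢ c v)
  (no-even-closed-path : ∀ k → ¬ Contains H (closedPath (suc (suc (k + k))))) where

  -- A simple path from u to v with k edges; its vertex list starts at v and ends at u.
  data SimplePath (u : Fin (size H)) : Fin (size H) → (k : ℕ) → Vec (Fin (size H)) (suc k) → Set where
    trivial : SimplePath u u 0 (u ∷ [])
    extend  : ∀ {v w k l} → SimplePath u v k l → adjacent H w v ≡ true → (w ∈ᵇ l) ≡ false →
              SimplePath u w (suc k) (w ∷ l)

  Connected : Fin (size H) → Fin (size H) → Set
  Connected u v = ∃₂ λ k (l : Vec (Fin (size H)) (suc k)) → SimplePath u v k l

  simplePath-distinct : ∀ {u v k l} → SimplePath u v k l → distinct l ≡ true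
  simplePath-distinct trivial            = refl
  simplePath-distinct (extend p _ w∉l) rewrite w∉l = simplePath-distinct p

  simplePath-length< : ∀ {u v k l} → SimplePath u v k l → k < size H
  simplePath-length< {l = l} p = distinct⇒length≤ l (simplePath-distinct p)

  connected-on-path : ∀ {u v k l} → SimplePath u v k l → ∀ x → (x ∈ᵇ l) ≡ true → Connected u x
  connected-on-path {u} trivial x x∈l with ∨≡true⁻ {x == u} x∈l
  ... | inj₁ x≟u with refl ← ==⇒≡ x u x≟u = _ , _ , trivial
  connected-on-path (extend {w = w} p a w∉l) x x∈l with ∨≡true⁻ {x == w} x∈l
  ... | inj₁ x≟w with refl ← ==⇒≡ x w x≟w = _ , _ , extend p a w∉l
  ... | inj₂ x∈l′ = connected-on-path p x x∈l′

  -- Extending by an edge back onto the path is handled by cutting the path there.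
  connected-step : ∀ {u v w} → Connected u v → adjacent H v w ≡ true → Connected u w
  connected-step {w = w} (k , l , p) a with w ∈ᵇ l in w∈l
  ... | true  = connected-on-path p w w∈l
  ... | false = _ , _ , extend p (trans (adjacent-sym H) a) w∈l

  Reachable : ℕ → Fin (size H) → Fin (size H) → Set
  Reachable zero    u v = u ≡ v
  Reachable (suc k) u v = Reachable k u v ⊎ ∃ λ w → Reachable k u w × adjacent H w v ≡ true

  reachable? : ∀ k u v → Dec (Reachable k u v)
  reachable? zero    u v = u Fin.≟ v
  reachable? (suc k) u v =
    reachable? k u v ⊎-dec Fin.any? (λ w → reachable? k u w ×-dec (adjacent H w v Bool.≟ true))

  reachable-mono : ∀ {k j u v} → k ≤′ j → Reachable k u v → Reachable j u v
  reachable-mono ≤′-refl        r = r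
  reachable-mono (≤′-step k≤′j) r = inj₁ (reachable-mono k≤′j r)

  reachable⇒connected : ∀ k {u v} → Reachable k u v → Connected u v
  reachable⇒connected zero    refl              = _ , _ , trivial
  reachable⇒connected (suc k) (inj₁ r)          = reachable⇒connected k r
  reachable⇒connected (suc k) (inj₂ (w , r , a)) = connected-step (reachable⇒connected k r) a

  simplePath⇒reachable : ∀ {u v k l} → SimplePath u v k l → Reachable k u v
  simplePath⇒reachable trivial        = refl
  simplePath⇒reachable (extend p a _) = inj₂ (_ , simplePath⇒reachable p , trans (adjacent-sym H) a)

  connected? : ∀ u v → Dec (Connected u v)
  connected? u v = map′ (reachable⇒connected (size H)) reach (reachable? (size H) u v)
    where
    reach : Connected u v → Reachable (size H) u v
    reach (k , l , p) = reachable-mono (≤⇒≤′ (<⇒≤ (simplePath-length< p))) (simplePath⇒reachable p)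

  simplePath-colour : ∀ {u v k l} → SimplePath u v k l →
    (c v ≡ c u × ∃ λ j → k ≡ j + j) ⊎ (c v ≡ not (c u) × ∃ λ j → k ≡ suc (j + j))
  simplePath-colour trivial = inj₁ (refl , 0 , refl)
  simplePath-colour (extend p a _) with simplePath-colour p
  ... | inj₁ (cv≡cu , j , refl) = inj₂ (trans cw≡¬cv (cong not cv≡cu) , j , refl)
    where cw≡¬cv = Bool.¬-not (c-proper _ _ a)
  ... | inj₂ (cv≡¬cu , j , refl) =
    inj₁ (trans cw≡¬cv (trans (cong not cv≡¬cu) (Bool.not-involutive _)) , suc j , cong suc (sym (+-suc j j)))
    where cw≡¬cv = Bool.¬-not (c-proper _ _ a)

  simplePath-head : ∀ {u v k l} → SimplePath u v k l → lookup l zero ≡ v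
  simplePath-head trivial        = refl
  simplePath-head (extend _ _ _) = refl

  simplePath-last : ∀ {u v k l} → SimplePath u v k l → lookup l (fromℕ k) ≡ u
  simplePath-last trivial        = refl
  simplePath-last (extend p _ _) = simplePath-last p

  simplePath-adjacent : ∀ {u v k l} → SimplePath u v k l →
                        ∀ i → adjacent H (lookup l (inject₁ i)) (lookup l (suc i)) ≡ true
  simplePath-adjacent (extend p a _) zero    = subst (λ x → adjacent H _ x ≡ true) (sym (simplePath-head p)) a
  simplePath-adjacent (extend p _ _) (suc i) = simplePath-adjacent p i

  simplePath⇒closedPath : ∀ {u v k l} → SimplePath u v k l → IsEdge H ⁅ u ⁆ → IsEdge H ⁅ v ⁆ →
                          Contains H (closedPath (suc k))
  simplePath⇒closedPath {u} {v} {k} {l} p eu ev =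
    lookup l , distinct⇒lookup-injective l (simplePath-distinct p) , edges
    where
    edges : ∀ F → IsEdge (closedPath (suc k)) F → IsEdge H (image (lookup l) F)
    edges F e with closedPath-edges k F e
    ... | inj₁ refl =
      subst (IsEdge H) (sym (trans (image-⁅⁆ (lookup l) zero) (cong ⁅_⁆ (simplePath-head p)))) ev
    ... | inj₂ (inj₁ refl) =
      subst (IsEdge H) (sym (trans (image-⁅⁆ (lookup l) (fromℕ k)) (cong ⁅_⁆ (simplePath-last p)))) eu
    ... | inj₂ (inj₂ (i , refl)) =
      subst (IsEdge H) (sym (image-pair (lookup l) (inject₁ i) (suc i))) (adjacent⇒edge H (simplePath-adjacent p i))

  -- An odd path between two vertices with 1-edges would close up to some P̄_2k.
  one-vertices-same-colour : ∀ {u v} → IsEdge H ⁅ u ⁆ → IsEdge H ⁅ v ⁆ → Connected u v → c u ≡ c v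
  one-vertices-same-colour eu ev (k , l , p) with simplePath-colour p
  ... | inj₁ (cv≡cu , _)    = sym cv≡cu
  ... | inj₂ (_ , j , refl) = contradiction (simplePath⇒closedPath p eu ev) (no-even-closed-path j)

  Flipped : Fin (size H) → Set
  Flipped v = ∃ λ u → IsEdge H ⁅ u ⁆ × Connected u v × c u ≡ false

  flipped? : ∀ v → Dec (Flipped v)
  flipped? v = Fin.any? λ u → (edge H ⁅ u ⁆ Bool.≟ true) ×-dec connected? u v ×-dec (c u Bool.≟ false)

  -- Swap the two colour classes in each component that contains a 1-vertex coloured false.
  c′ : Fin (size H) → Bool
  c′ v = c v xor does (flipped? v)

  flipped-adjacent : ∀ {v w} → adjacent H v w ≡ true → does (flipped? v) ≡ does (flipped? w)
  flipped-adjacent a = does-⇔ (mk⇔ (move a) (move (trans (adjacent-sym H) a))) (flipped? _) (flipped? _)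
    where
    move : ∀ {v w} → adjacent H v w ≡ true → Flipped v → Flipped w
    move a (u , e , conn , cu) = u , e , connected-step conn a , cu

  c′-proper : ∀ v w → adjacent H v w ≡ true → c′ v ≢ c′ w
  c′-proper v w a c′v≡c′w = Bool.not-¬ refl (trans (sym c′v≡c′w) c′v≡¬c′w)
    where
    c′v≡¬c′w : c′ v ≡ not (c′ w)
    c′v≡¬c′w = trans (cong₂ _xor_ (Bool.¬-not (c-proper v w a)) (flipped-adjacent a))
                     (sym (Bool.not-distribˡ-xor (c w) (does (flipped? w))))

  c′-one : ∀ u → IsEdge H ⁅ u ⁆ → c′ u ≡ true
  c′-one u e with c u in cu
  ... | false = dec-true (flipped? u) (u , e , (_ , _ , trivial) , cu)
  ... | true  = cong not (dec-false (flipped? u) λ (u′ , e′ , conn , cu′) →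
                  contradiction (trans (sym cu′) (trans (one-vertices-same-colour e′ e conn) cu)) λ ())

-- Upper bound on h_n for H-free hypergraphs

module _ (H G : Hypergraph) (c : Fin (size H) → Bool)
  (c-one : ∀ u → IsEdge H ⁅ u ⁆ → c u ≡ true)
  (c-proper : ∀ u v → adjacent H u v ≡ true → c u ≢ c v)
  (sizes : ∀ F → IsEdge H F → ∣ F ∣ ≡ 1 ⊎ ∣ F ∣ ≡ 2)
  (σ τ : Fin (size H) → Fin (size G)) (σ-injective : Injective _≡_ _≡_ σ) (τ-injective : Injective _≡_ _≡_ τ)
  (σ-one : ∀ i → IsEdge G ⁅ σ i ⁆) (σ-τ-adjacent : ∀ i j → adjacent G (σ i) (τ j) ≡ true) where

  private
    embedding : Fin (size H) → Fin (size G)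
    embedding v = if c v then σ v else τ v

    embedding-true : ∀ {v} → c v ≡ true → embedding v ≡ σ v
    embedding-true cv rewrite cv = refl

    embedding-false : ∀ {v} → c v ≡ false → embedding v ≡ τ v
    embedding-false cv rewrite cv = refl

    embedding-injective : Injective _≡_ _≡_ embedding
    embedding-injective {a} {b} eq with c a | c b
    ... | true  | true  = σ-injective eq
    ... | false | false = τ-injective eq
    ... | true  | false = contradiction eq (adjacent⇒≢ G (σ-τ-adjacent a b))
    ... | false | true  = contradiction (sym eq) (adjacent⇒≢ G (σ-τ-adjacent b a))

    pair-edge : ∀ {u v} → c u ≡ true → c v ≡ false → IsEdge G (⁅ embedding u ⁆ ∪ ⁅ embedding v ⁆)
    pair-edge {u} {v} cu cv =
      subst (IsEdge G) (cong₂ (λ x y → ⁅ x ⁆ ∪ ⁅ y ⁆) (sym (embedding-true cu)) (sym (embedding-false cv)))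
            (adjacent⇒edge G (σ-τ-adjacent u v))

    embedding-edges : ∀ F → IsEdge H F → IsEdge G (image embedding F)
    embedding-edges F e with sizes F e
    ... | inj₁ ∣F∣≡1 with ∣p∣≡1⇒p≡⁅x⁆ F ∣F∣≡1
    ...   | u , refl =
      subst (IsEdge G) (sym (trans (image-⁅⁆ embedding u) (cong ⁅_⁆ (embedding-true (c-one u e))))) (σ-one u)
    embedding-edges F e | inj₂ ∣F∣≡2 with ∣p∣≡2⇒p≡pair F ∣F∣≡2
    ...   | u , v , u≢v , refl with c u in cu | c v in cv
    ...     | true  | false = subst (IsEdge G) (sym (image-pair embedding u v)) (pair-edge cu cv)
    ...     | false | true  = subst (IsEdge G) (sym (trans (image-pair embedding u v) (∪-comm _ _))) (pair-edge cv cu)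
    ...     | true  | true  = contradiction (trans cu (sym cv)) (c-proper u v (edge⇒adjacent H e u≢v))
    ...     | false | false = contradiction (trans cu (sym cv)) (c-proper u v (edge⇒adjacent H e u≢v))

  two-coloured-embedding : Contains G H
  two-coloured-embedding = embedding , embedding-injective , embedding-edges

oneNeighbour : (G : Hypergraph) → Fin (size G) → Fin (size G) → Bool
oneNeighbour G y x = edge G ⁅ x ⁆ ∧ adjacent G x y

module _ (G : Hypergraph) {y x : Fin (size G)} (n : oneNeighbour G y x ≡ true) where

  oneNeighbour⇒one : IsEdge G ⁅ x ⁆
  oneNeighbour⇒one = proj₁ (∧≡true⁻ {edge G ⁅ x ⁆} n)

  oneNeighbour⇒adjacent : adjacent G x y ≡ true
  oneNeighbour⇒adjacent = proj₂ (∧≡true⁻ {edge G ⁅ x ⁆} n)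

module Counting (G : Hypergraph) where

  ones nonOnes pairs oneDegrees : ℕ
  ones       = ∑[ x < size G ] 𝟙 (edge G ⁅ x ⁆)
  nonOnes    = ∑[ x < size G ] 𝟙 (not (edge G ⁅ x ⁆))
  pairs      = ∑-subsets (size G) (λ F → 𝟙 (∣ F ∣ ≡ᵇ 2) * 𝟙 (edge G F))
  oneDegrees = ∑[ y < size G ] ∑[ x < size G ] 𝟙 (oneNeighbour G y x)

  ones+nonOnes≡size : ones + nonOnes ≡ size G
  ones+nonOnes≡size = begin
    ones + nonOnes
      ≡⟨ ∑-distrib-+ (λ x → 𝟙 (edge G ⁅ x ⁆)) (λ x → 𝟙 (not (edge G ⁅ x ⁆))) ⟨
    ∑[ x < size G ] (𝟙 (edge G ⁅ x ⁆) + 𝟙 (not (edge G ⁅ x ⁆))) ≡⟨ sum-cong-≗ {size G} (λ x → 𝟙-not (edge G ⁅ x ⁆)) ⟩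
    ∑[ x < size G ] 1                                             ≡⟨ sum-const (size G) 1 ⟩
    size G * 1                                                    ≡⟨ *-identityʳ (size G) ⟩
    size G                                                        ∎
    where open ≡-Reasoning

  2*pairs≡∑∑adjacent : 2 * pairs ≡ ∑[ x < size G ] ∑[ y < size G ] 𝟙 (adjacent G x y)
  2*pairs≡∑∑adjacent = trans (∑-subsets-size2 (size G) (λ F → 𝟙 (edge G F)))
    (sum-cong-≗ {size G} λ x → sum-cong-≗ {size G} λ y →
      trans (*-comm (𝟙 (not (x == y))) _) (sym (𝟙-∧ (edge G (⁅ x ⁆ ∪ ⁅ y ⁆)) (not (x == y)))))

  -- An edge xy is counted in oneDegrees from x or from y unless x carries no 1-edge.
  ∑∑adjacent≤ : ∑[ x < size G ] ∑[ y < size G ] 𝟙 (adjacent G x y) ≤ oneDegrees + oneDegrees + size G * nonOnes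
  ∑∑adjacent≤ = begin
    ∑[ x < n ] ∑[ y < n ] 𝟙 (adjacent G x y)
      ≤⟨ sum-mono-≤ {n} (λ x → sum-mono-≤ {n} (λ y → split (edge G ⁅ x ⁆) (edge G ⁅ y ⁆) (adjacent G x y))) ⟩
    ∑[ x < n ] ∑[ y < n ] (A x y + B x y + C x)
      ≡⟨ sum-cong-≗ {n} (λ x → trans (∑-distrib-+ (λ y → A x y + B x y) (λ _ → C x))
                                     (cong (_+ ∑[ y < n ] C x) (∑-distrib-+ (A x) (B x)))) ⟩
    ∑[ x < n ] (∑[ y < n ] A x y + ∑[ y < n ] B x y + ∑[ y < n ] C x)
      ≡⟨ trans (∑-distrib-+ (λ x → ∑[ y < n ] A x y + ∑[ y < n ] B x y) (λ x → ∑[ y < n ] C x))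
               (cong (_+ ∑[ x < n ] ∑[ y < n ] C x) (∑-distrib-+ (λ x → ∑[ y < n ] A x y) (λ x → ∑[ y < n ] B x y))) ⟩
    ∑[ x < n ] ∑[ y < n ] A x y + ∑[ x < n ] ∑[ y < n ] B x y + ∑[ x < n ] ∑[ y < n ] C x
      ≡⟨ cong₂ (λ a b → a + b + ∑[ x < n ] ∑[ y < n ] C x) (∑-comm A)
               (sum-cong-≗ {n} λ x → sum-cong-≗ {n} λ y → cong (λ b → 𝟙 (edge G ⁅ y ⁆ ∧ b)) (adjacent-sym G)) ⟩
    oneDegrees + oneDegrees + ∑[ x < n ] ∑[ y < n ] C x
      ≡⟨ cong (oneDegrees + oneDegrees +_)
              (trans (sum-cong-≗ {n} (λ x → sum-const n (C x))) (sym (*-distribˡ-sum n C))) ⟩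
    oneDegrees + oneDegrees + n * nonOnes ∎
    where
    open ≤-Reasoning
    n = size G
    A B : Fin n → Fin n → ℕ
    A x y = 𝟙 (oneNeighbour G y x)
    B x y = 𝟙 (edge G ⁅ y ⁆ ∧ adjacent G x y)
    C : Fin n → ℕ
    C x = 𝟙 (not (edge G ⁅ x ⁆))
    split : ∀ ax ay r → 𝟙 r ≤ 𝟙 (ax ∧ r) + 𝟙 (ay ∧ r) + 𝟙 (not ax)
    split true  ay true  = s≤s z≤n
    split false ay true  = m≤n+m 1 _
    split ax    ay false = z≤n

^-distribʳ-* : ∀ m n k → (m * n) ^ k ≡ m ^ k * n ^ k
^-distribʳ-* m n zero    = refl
^-distribʳ-* m n (suc k) = trans (cong (m * n *_) (^-distribʳ-* m n k)) (interchange m n (m ^ k) (n ^ k))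
  where interchange : ∀ a b c d → a * b * (c * d) ≡ a * c * (b * d)
        interchange = solve-∀

-- h_n(G) ≤ 1 + 1/M with denominators cleared, for n = n′ + 1 vertices, a 1-edges, b = n - a and e₂ 2-edges.
density-bound : ∀ M n′ a b e₂ D m →
  a + b ≡ suc n′ → 2 * e₂ ≤ D + D + suc n′ * b → D < m * suc n′ + m * suc n′ → M * (1 + 4 * m) ≤ n′ →
  M * (a * n′ + 2 * e₂) ≤ suc M * (suc n′ * n′)
density-bound M n′ a b e₂ D m a+b≡n 2e₂≤ D< M[1+4m]≤n′ = begin
  M * (a * n′ + 2 * e₂)                              ≤⟨ *-monoʳ-≤ M (+-monoʳ-≤ (a * n′) 2e₂≤) ⟩
  M * (a * n′ + (D + D + n * b))                     ≡⟨ cong (M *_) (regroup a n′ D b) ⟩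
  M * ((a + b) * n′ + b + (D + D))                   ≡⟨ cong (λ z → M * (z * n′ + b + (D + D))) a+b≡n ⟩
  M * (n * n′ + b + (D + D))
    ≤⟨ *-monoʳ-≤ M (+-mono-≤ (+-monoʳ-≤ (n * n′) b≤n) (+-mono-≤ (<⇒≤ D<) (<⇒≤ D<))) ⟩
  M * (n * n′ + n + (m * n + m * n + (m * n + m * n))) ≡⟨ collect M n n′ m ⟩
  M * (n * n′) + n * (M * (1 + 4 * m))               ≤⟨ +-monoʳ-≤ (M * (n * n′)) (*-monoʳ-≤ n M[1+4m]≤n′) ⟩
  M * (n * n′) + n * n′                              ≡⟨ +-comm (M * (n * n′)) (n * n′) ⟩
  suc M * (n * n′)                                   ∎
  where
  open ≤-Reasoning
  n : ℕ
  n = suc n′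
  b≤n : b ≤ n
  b≤n = subst (b ≤_) a+b≡n (m≤n+m b a)
  regroup : ∀ a n′ D b → a * n′ + (D + D + suc n′ * b) ≡ (a + b) * n′ + b + (D + D)
  regroup = solve-∀
  collect : ∀ M n n′ m → M * (n * n′ + n + (m * n + m * n + (m * n + m * n))) ≡ M * (n * n′) + n * (M * (1 + 4 * m))
  collect = solve-∀

threshold : ℕ → ℕ → ℕ
threshold M t = 10 * M + 2 + (t + t * t) * (8 * M) ^ suc t

2≤threshold : ∀ M t → 2 ≤ threshold M t
2≤threshold M t = ≤-trans (m≤n+m 2 (10 * M)) (m≤m+n _ _)

-- m = ⌊n / 8M⌋ + 1 is large enough for the Kővári–Sós–Turán count and small enough for density-bound.
∃-scale : ∀ M .{{_ : NonZero M}} t n → threshold M t ≤ n →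
          ∃ λ m → (t + t * t) * n ^ t < m ^ suc t × M * (1 + 4 * m) ≤ pred n
∃-scale M t n N≤n = m , kst-scale , density-scale
  where
  K = 8 * M
  instance
    K≢0 : NonZero K
    K≢0 = m*n≢0 8 M
  q = n / K
  m : ℕ
  m = suc q
  c = t + t * t
  cK^[1+t]<n : c * K ^ suc t < n
  cK^[1+t]<n = ≤-trans (+-monoˡ-≤ (c * K ^ suc t) (≤-trans (s≤s z≤n) (m≤n+m 2 (10 * M)))) N≤n
  instance
    n≢0 : NonZero n
    n≢0 = >-nonZero (≤-<-trans z≤n cK^[1+t]<n)
  n≤mK : n ≤ m * K
  n≤mK = begin
    n              ≡⟨ m≡m%n+[m/n]*n n K ⟩
    n % K + q * K  ≤⟨ +-monoˡ-≤ (q * K) (<⇒≤ (m%n<n n K)) ⟩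
    m * K          ∎
    where open ≤-Reasoning
  kst-scale : c * n ^ t < m ^ suc t
  kst-scale = *-cancelʳ-< (K ^ suc t) (c * n ^ t) (m ^ suc t) (begin-strict
    c * n ^ t * K ^ suc t    ≡⟨ swap c (n ^ t) (K ^ suc t) ⟩
    c * K ^ suc t * n ^ t    <⟨ *-monoˡ-< (n ^ t) {{m^n≢0 n t}} cK^[1+t]<n ⟩
    n ^ suc t                ≤⟨ ^-monoˡ-≤ (suc t) n≤mK ⟩
    (m * K) ^ suc t          ≡⟨ ^-distribʳ-* m K (suc t) ⟩
    m ^ suc t * K ^ suc t    ∎)
    where
    open ≤-Reasoning
    swap : ∀ a b c → a * b * c ≡ a * c * b
    swap = solve-∀
  density-scale : M * (1 + 4 * m) ≤ pred n
  density-scale = <⇒≤pred (*-cancelˡ-≤ {suc (M * (1 + 4 * m))} {n} 2 (begin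
    2 * suc (M * (1 + 4 * m))   ≡⟨ expand M q ⟩
    q * K + (10 * M + 2)        ≤⟨ +-mono-≤ (m/n*n≤m n K) (≤-trans (m≤m+n (10 * M + 2) _) N≤n) ⟩
    n + n                       ≡⟨ cong (n +_) (+-identityʳ n) ⟨
    2 * n                       ∎))
    where
    open ≤-Reasoning
    expand : ∀ M q → 2 * suc (M * (1 + 4 * suc q)) ≡ q * (8 * M) + (10 * M + 2)
    expand = solve-∀

module _ (H : Hypergraph) (sizes : ∀ F → IsEdge H F → ∣ F ∣ ≡ 1 ⊎ ∣ F ∣ ≡ 2)
  (bipartite : TwoGraphBipartite H)
  (no-even-closed-path : ∀ k → ¬ Contains H (closedPath (suc (suc (k + k))))) where

  private
    c = proj₁ bipartite
    c-proper = bipartite⇒adjacent-colours-differ H c (proj₂ bipartite)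
    open Recolouring H c c-proper no-even-closed-path using (c′; c′-one; c′-proper)

  no-K[t,t] : ∀ G → ¬ Contains G H → ∀ s τ → distinct s ≡ true → distinct τ ≡ true →
              ¬ allᵇ (λ y → allᵇ (oneNeighbour G y) s) τ ≡ true
  no-K[t,t] G G⊉H s τ distinct-s distinct-τ K = G⊉H
    (two-coloured-embedding H G c′ c′-one c′-proper sizes (lookup s) (lookup τ)
      (distinct⇒lookup-injective s distinct-s) (distinct⇒lookup-injective τ distinct-τ)
      (λ i → oneNeighbour⇒one G (oneNeighbour-σ-τ i i)) (λ i j → oneNeighbour⇒adjacent G (oneNeighbour-σ-τ i j)))
    where
    oneNeighbour-σ-τ : ∀ i j → oneNeighbour G (lookup τ j) (lookup s i) ≡ true
    oneNeighbour-σ-τ i j = allᵇ⇒lookup _ s (allᵇ⇒lookup _ τ K j) i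

  H-free-density : ∀ M .{{_ : NonZero M}} G → threshold M (size H) ≤ size G → ¬ Contains G H →
    let open Counting G in M * (ones * pred (size G) + 2 * pairs) ≤ suc M * (size G * pred (size G))
  H-free-density M (hg zero    e) N≤0 G⊉H =
    contradiction (≤-trans (2≤threshold M (size H)) N≤0) λ ()
  H-free-density M G@(hg (suc n′) e) N≤n G⊉H =
    density-bound M n′ ones nonOnes pairs oneDegrees m ones+nonOnes≡size
      (subst (_≤ oneDegrees + oneDegrees + size G * nonOnes) (sym 2*pairs≡∑∑adjacent) ∑∑adjacent≤)
      (KővariSósTurán.no-K[t,t]⇒∑deg< (size H) (oneNeighbour G) m kst-scale (no-K[t,t] G G⊉H))
      density-scale
    where
    open Counting G
    scale = ∃-scale M (size H) (suc n′) N≤n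
    m = proj₁ scale
    kst-scale = proj₁ (proj₂ scale)
    density-scale = proj₂ (proj₂ scale)

infixl 7 _÷_

_÷_ : ℕ → (d : ℕ) → .{{NonZero d}} → ℚ
a ÷ d = ℤ.+ a ℚ./ d

private
  toℚᵘ-÷ : ∀ a d → toℚᵘ (a ÷ suc d) ℚᵘ.≃ mkℚᵘ (ℤ.+ a) d
  toℚᵘ-÷ a d = ℚ.toℚᵘ-fromℚᵘ (mkℚᵘ (ℤ.+ a) d)

  +*+ : ∀ a b → ℤ.+ a ℤ.* ℤ.+ b ≡ ℤ.+ (a * b)
  +*+ a b = sym (ℤ.pos-* a b)

÷-cong : ∀ a d b d′ → a * suc d′ ≡ b * suc d → a ÷ suc d ≡ b ÷ suc d′
÷-cong a d b d′ eq = ℚ.toℚᵘ-injective (ℚᵘ.≃-trans (toℚᵘ-÷ a d) (ℚᵘ.≃-trans cross (ℚᵘ.≃-sym (toℚᵘ-÷ b d′))))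
  where cross = *≡* (trans (+*+ a (suc d′)) (trans (cong ℤ.+_ eq) (sym (+*+ b (suc d)))))

÷-mono-≤ : ∀ a d b d′ → a * suc d′ ≤ b * suc d → a ÷ suc d ℚ.≤ b ÷ suc d′
÷-mono-≤ a d b d′ le =
  ℚ.toℚᵘ-cancel-≤ (ℚᵘ.≤-respʳ-≃ (ℚᵘ.≃-sym (toℚᵘ-÷ b d′)) (ℚᵘ.≤-respˡ-≃ (ℚᵘ.≃-sym (toℚᵘ-÷ a d)) cross))
  where cross = *≤* (subst₂ ℤ._≤_ (sym (+*+ a (suc d′))) (sym (+*+ b (suc d))) (+≤+ le))

0÷ : ∀ d → 0 ÷ suc d ≡ 0ℚ
0÷ d = ÷-cong 0 d 0 0 refl

n÷n : ∀ d → suc d ÷ suc d ≡ 1ℚ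
n÷n d = ÷-cong (suc d) d 1 0 (*-comm (suc d) 1)

÷-distribʳ-+ : ∀ a b d → (a + b) ÷ suc d ≡ a ÷ suc d ℚ.+ b ÷ suc d
÷-distribʳ-+ a b d = ℚ.toℚᵘ-injective (ℚᵘ.≃-sym
  (ℚᵘ.≃-trans (ℚ.toℚᵘ-homo-+ (a ÷ suc d) (b ÷ suc d))
  (ℚᵘ.≃-trans (ℚᵘ.+-cong (toℚᵘ-÷ a d) (toℚᵘ-÷ b d))
  (ℚᵘ.≃-trans (*≡* cross) (ℚᵘ.≃-sym (toℚᵘ-÷ (a + b) d))))))
  where
  open ≡-Reasoning
  s : ℕ
  s = suc d
  cross : (ℤ.+ a ℤ.* ℤ.+ s ℤ.+ ℤ.+ b ℤ.* ℤ.+ s) ℤ.* ℤ.+ s ≡ ℤ.+ (a + b) ℤ.* ℤ.+ (s * s)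
  cross = begin
    (ℤ.+ a ℤ.* ℤ.+ s ℤ.+ ℤ.+ b ℤ.* ℤ.+ s) ℤ.* ℤ.+ s   ≡⟨ cong (ℤ._* ℤ.+ s) (cong₂ ℤ._+_ (+*+ a s) (+*+ b s)) ⟩
    (ℤ.+ (a * s) ℤ.+ ℤ.+ (b * s)) ℤ.* ℤ.+ s         ≡⟨ +*+ (a * s + b * s) s ⟩
    ℤ.+ ((a * s + b * s) * s)                       ≡⟨ cong ℤ.+_ (regroup a b s) ⟩
    ℤ.+ ((a + b) * (s * s))                         ≡⟨ +*+ (a + b) (s * s) ⟨
    ℤ.+ (a + b) ℤ.* ℤ.+ (s * s)                     ∎
    where
    regroup : ∀ a b s → (a * s + b * s) * s ≡ (a + b) * (s * s)
    regroup = solve-∀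

-- Every positive rational p / (q + 1) exceeds 1 / (q + 2).
∃-1÷<ε : ∀ ε → 0ℚ ℚ.< ε → ∃ λ M → 1 ÷ suc M ℚ.< ε
∃-1÷<ε (mkℚ (ℤ.+ zero)   q _) 0<ε with +<+ () ← ℚ.drop-*<* 0<ε
∃-1÷<ε (mkℚ ℤ.-[1+ p ] q _) 0<ε with () ← ℚ.drop-*<* 0<ε
∃-1÷<ε (mkℚ (ℤ.+ suc p)  q _) _   = suc q , ℚ.toℚᵘ-cancel-< (ℚᵘ.<-respˡ-≃ (ℚᵘ.≃-sym (toℚᵘ-÷ 1 (suc q))) cross)
  where
  cross : mkℚᵘ (ℤ.+ 1) (suc q) ℚᵘ.< mkℚᵘ (ℤ.+ suc p) q
  cross = *<* (subst₂ ℤ._<_ (sym (+*+ 1 (suc q))) (sym (+*+ (suc p) (suc (suc q))))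
                (+<+ (≤-trans (≤-reflexive (cong suc (*-identityˡ (suc q)))) (m≤m+n (suc (suc q)) _))))

∣x-y∣<ε : ∀ {x y δ ε} → y ℚ.≤ x → x ℚ.≤ y ℚ.+ δ → δ ℚ.< ε → ℚ.∣ x ℚ.- y ∣ ℚ.< ε
∣x-y∣<ε {x} {y} {δ} {ε} y≤x x≤y+δ δ<ε = begin-strict
  ℚ.∣ x ℚ.- y ∣     ≡⟨ ℚ.0≤p⇒∣p∣≡p 0≤x-y ⟩
  x ℚ.- y           ≤⟨ ℚ.+-monoˡ-≤ (ℚ.- y) x≤y+δ ⟩
  y ℚ.+ δ ℚ.- y     ≡⟨ cong (ℚ._- y) (ℚ.+-comm y δ) ⟩
  δ ℚ.+ y ℚ.- y     ≡⟨ ℚ.+-assoc δ y (ℚ.- y) ⟩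
  δ ℚ.+ (y ℚ.- y)   ≡⟨ cong (δ ℚ.+_) (ℚ.+-inverseʳ y) ⟩
  δ ℚ.+ 0ℚ          ≡⟨ ℚ.+-identityʳ δ ⟩
  δ                 <⟨ δ<ε ⟩
  ε                 ∎
  where
  open ℚ.≤-Reasoning
  0≤x-y : 0ℚ ℚ.≤ x ℚ.- y
  0≤x-y = subst (ℚ._≤ x ℚ.- y) (ℚ.+-inverseʳ y) (ℚ.+-monoˡ-≤ (ℚ.- y) y≤x)

2*[1+n]C2 : ∀ n → 2 * (suc n C 2) ≡ suc n * n
2*[1+n]C2 zero    = refl
2*[1+n]C2 (suc n) = begin
  2 * (suc (suc n) C 2)            ≡⟨ cong (2 *_) (nCk+nC[k+1]≡[n+1]C[k+1] (suc n) 1) ⟨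
  2 * (suc n C 1 + suc n C 2)      ≡⟨ cong (λ c → 2 * (c + suc n C 2)) (nC1≡n (suc n)) ⟩
  2 * (suc n + suc n C 2)          ≡⟨ *-distribˡ-+ 2 (suc n) _ ⟩
  2 * suc n + 2 * (suc n C 2)      ≡⟨ cong (2 * suc n +_) (2*[1+n]C2 n) ⟩
  2 * suc n + suc n * n            ≡⟨ expand n ⟩
  suc (suc n) * suc n              ∎
  where
  open ≡-Reasoning
  expand : ∀ n → 2 * suc n + suc n * n ≡ suc (suc n) * suc n
  expand = solve-∀

module _ (m : ℕ) where

  private
    n d : ℕ
    n = suc (suc m)
    d = pred (n * suc m)

  -- 1/n and 1/C(n,2) over the common denominator n(n-1)
  inv[nC1] : inv (n C 1) ≡ suc m ÷ suc d
  inv[nC1] = trans (cong inv (nC1≡n n)) (÷-cong 1 (suc m) (suc m) d (expand m))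
    where expand : ∀ m → 1 * (suc (suc m) * suc m) ≡ suc m * suc (suc m)
          expand = solve-∀

  inv[nC2] : inv (n C 2) ≡ 2 ÷ suc d
  inv[nC2] = via-double (n C 2) (2*[1+n]C2 (suc m))
    where
    via-double : ∀ c → 2 * c ≡ n * suc m → inv c ≡ 2 ÷ suc d
    via-double (suc c) 2[1+c]≡n[n-1] = ÷-cong 1 c 2 d (trans (*-identityˡ _) (sym 2[1+c]≡n[n-1]))

  edge-weight : Bool → ℕ → ℕ
  edge-weight b k = 𝟙 (k ≡ᵇ 1) * (𝟙 b * suc m) + 𝟙 (k ≡ᵇ 2) * (𝟙 b * 2)

  edge-weight-÷ : ∀ b k → (b ≡ true → k ≡ 1 ⊎ k ≡ 2) →
                  (if b then inv (n C k) else 0ℚ) ≡ edge-weight b k ÷ suc d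
  edge-weight-÷ false k _     =
    trans (sym (0÷ d)) (cong (_÷ suc d) (sym (cong₂ _+_ (*-zeroʳ (𝟙 (k ≡ᵇ 1))) (*-zeroʳ (𝟙 (k ≡ᵇ 2))))))
  edge-weight-÷ true  k sizes with sizes refl
  ... | inj₁ refl =
    trans inv[nC1] (cong (_÷ suc d) (sym (trans (+-identityʳ _) (trans (+-identityʳ _) (*-identityˡ (suc m))))))
  ... | inj₂ refl = inv[nC2]

  sum-÷ : (L : List (Subset n)) (w : Subset n → ℕ) →
          foldr ℚ._+_ 0ℚ (map (λ F → w F ÷ suc d) L) ≡ foldr _+_ 0 (map w L) ÷ suc d
  sum-÷ []      w = sym (0÷ d)
  sum-÷ (F ∷ L) w = trans (cong (w F ÷ suc d ℚ.+_) (sum-÷ L w)) (sym (÷-distribʳ-+ (w F) _ d))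

  h-formula : ∀ e → (∀ F → IsEdge (hg n e) F → ∣ F ∣ ≡ 1 ⊎ ∣ F ∣ ≡ 2) →
              let open Counting (hg n e) in h (hg n e) ≡ (ones * suc m + 2 * pairs) ÷ (n * suc m)
  h-formula e sizes = begin
    foldr ℚ._+_ 0ℚ (map (λ F → if e F then inv (n C ∣ F ∣) else 0ℚ) (allSubsets n))
      ≡⟨ cong (foldr ℚ._+_ 0ℚ) (map-cong (λ F → edge-weight-÷ (e F) ∣ F ∣ (sizes F)) (allSubsets n)) ⟩
    foldr ℚ._+_ 0ℚ (map (λ F → w F ÷ suc d) (allSubsets n))
      ≡⟨ sum-÷ (allSubsets n) w ⟩
    foldr _+_ 0 (map w (allSubsets n)) ÷ suc d
      ≡⟨ cong (_÷ suc d) (trans (sum-allSubsets n w) ∑w≡) ⟩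
    (ones * suc m + 2 * pairs) ÷ suc d ∎
    where
    open ≡-Reasoning
    open Counting (hg n e)
    w : Subset n → ℕ
    w F = edge-weight (e F) ∣ F ∣
    ∑w≡ : ∑-subsets n w ≡ ones * suc m + 2 * pairs
    ∑w≡ = begin
      ∑-subsets n w
        ≡⟨ ∑-subsets-distrib-+ n (λ F → 𝟙 (∣ F ∣ ≡ᵇ 1) * (𝟙 (e F) * suc m)) (λ F → 𝟙 (∣ F ∣ ≡ᵇ 2) * (𝟙 (e F) * 2)) ⟩
      ∑-subsets n (λ F → 𝟙 (∣ F ∣ ≡ᵇ 1) * (𝟙 (e F) * suc m)) + ∑-subsets n (λ F → 𝟙 (∣ F ∣ ≡ᵇ 2) * (𝟙 (e F) * 2))
        ≡⟨ cong₂ _+_ (∑-subsets-size1 n (λ F → 𝟙 (e F) * suc m))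
                     (∑-subsets-cong n (λ F → swap (𝟙 (∣ F ∣ ≡ᵇ 2)) (𝟙 (e F)))) ⟩
      ∑[ x < n ] (𝟙 (e ⁅ x ⁆) * suc m) + ∑-subsets n (λ F → 2 * (𝟙 (∣ F ∣ ≡ᵇ 2) * 𝟙 (e F)))
        ≡⟨ cong₂ _+_ (sum-cong-≗ {n} (λ x → *-comm (suc m) (𝟙 (e ⁅ x ⁆))))
                     (*-distribˡ-∑-subsets n 2 (λ F → 𝟙 (∣ F ∣ ≡ᵇ 2) * 𝟙 (e F))) ⟨
      ∑[ x < n ] (suc m * 𝟙 (e ⁅ x ⁆)) + 2 * pairs
        ≡⟨ cong (_+ 2 * pairs) (trans (*-comm ones (suc m)) (*-distribˡ-sum (suc m) (λ x → 𝟙 (e ⁅ x ⁆)))) ⟨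
      ones * suc m + 2 * pairs ∎
      where swap : ∀ x y → x * (y * 2) ≡ 2 * (x * y)
            swap = solve-∀

singletons : ℕ → Hypergraph
singletons n = hg n (λ F → ∣ F ∣ ≡ᵇ 1)

singleton-edge-size : ∀ {n} F → IsEdge (singletons n) F → ∣ F ∣ ≡ 1
singleton-edge-size F e = ≡ᵇ⇒≡ ∣ F ∣ 1 (subst T (sym e) _)

h[singletons]≡1 : ∀ m → h (singletons (suc (suc m))) ≡ 1ℚ
h[singletons]≡1 m = begin
  h (singletons n)                              ≡⟨ h-formula m _ (λ F → inj₁ ∘ singleton-edge-size F) ⟩
  (ones * suc m + 2 * pairs) ÷ (n * suc m)      ≡⟨ cong₂ (λ a b → (a * suc m + 2 * b) ÷ (n * suc m)) ones≡n pairs≡0 ⟩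
  (n * suc m + 2 * 0) ÷ (n * suc m)             ≡⟨ cong (_÷ (n * suc m)) (+-identityʳ (n * suc m)) ⟩
  (n * suc m) ÷ (n * suc m)                     ≡⟨ n÷n (pred (n * suc m)) ⟩
  1ℚ                                            ∎
  where
  open ≡-Reasoning
  n : ℕ
  n = suc (suc m)
  open Counting (singletons n)
  ones≡n : ones ≡ n
  ones≡n = trans (sum-cong-≗ {n} (λ x → cong (λ k → 𝟙 (k ≡ᵇ 1)) (∣⁅x⁆∣≡1 x)))
                 (trans (sum-const n 1) (*-identityʳ n))
  pairs≡0 : pairs ≡ 0
  pairs≡0 = trans (∑-subsets-cong n (λ F → 2≢1 ∣ F ∣)) (∑-subsets-0 n)
    where 2≢1 : ∀ k → 𝟙 (k ≡ᵇ 2) * 𝟙 (k ≡ᵇ 1) ≡ 0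
          2≢1 0 = refl
          2≢1 1 = refl
          2≢1 2 = refl
          2≢1 (suc (suc (suc k))) = refl

singletons-admissible : ∀ H → RIs12 H → ∀ n → Admissible H n (singletons n)
singletons-admissible H (_ , (F₁ , e₁ , ∣F₁∣≡1) , (F₂ , e₂ , ∣F₂∣≡2)) n = refl , sizes⊆ , H⊄
  where
  sizes⊆ : RSub (singletons n) H
  sizes⊆ F e = F₁ , e₁ , trans ∣F₁∣≡1 (sym (singleton-edge-size F e))
  H⊄ : ¬ Contains (singletons n) H
  H⊄ (f , f-injective , f-edges) with ∣p∣≡2⇒p≡pair F₂ ∣F₂∣≡2
  ... | u , v , u≢v , refl = contradiction (trans (sym ∣image∣≡1) ∣pair∣≡2′) λ ()
    where
    ∣image∣≡1 = singleton-edge-size (image f (⁅ u ⁆ ∪ ⁅ v ⁆)) (f-edges _ e₂)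
    ∣pair∣≡2′ = trans (cong ∣_∣ (image-pair f u v)) (∣pair∣≡2 (u≢v ∘ f-injective))

-- π_n(H) is attained

join : ∀ {n} → (Subset n → Bool) → (Subset n → Bool) → Subset (suc n) → Bool
join e₁ e₀ (true  ∷ F) = e₁ F
join e₁ e₀ (false ∷ F) = e₀ F

-- Every edge set on n vertices, as an indicator function (complete up to pointwise equality).
edgeFunctions : (n : ℕ) → List (Subset n → Bool)
edgeFunctions zero    = (λ _ → true) ∷ (λ _ → false) ∷ []
edgeFunctions (suc n) = cartesianProductWith join (edgeFunctions n) (edgeFunctions n)

edgeFunctions-complete : ∀ n (e : Subset n → Bool) → ∃ λ e′ → e′ List.∈ edgeFunctions n × (∀ F → e F ≡ e′ F)
edgeFunctions-complete zero e with e [] in e[]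
... | true  = _ , here refl , λ { [] → e[] }
... | false = _ , there (here refl) , λ { [] → e[] }
edgeFunctions-complete (suc n) e
  with e₁ , e₁∈ , e≗e₁ ← edgeFunctions-complete n (e ∘ (true ∷_))
     | e₀ , e₀∈ , e≗e₀ ← edgeFunctions-complete n (e ∘ (false ∷_))
  = join e₁ e₀ , ∈-cartesianProductWith⁺ join e₁∈ e₀∈ , λ { (true ∷ F) → e≗e₁ F ; (false ∷ F) → e≗e₀ F }

all-subsets? : ∀ {n} {P : Subset n → Set} → (∀ F → Dec (P F)) → Dec (∀ F → P F)
all-subsets? P? with anySubset? (¬? ∘ P?)
... | yes (F , ¬PF) = no λ ∀P → ¬PF (∀P F)
... | no  ∄¬P       = yes λ F → decidable-stable (P? F) (λ ¬PF → ∄¬P (F , ¬PF))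

any-vector? : ∀ {n} t {P : Vec (Fin n) t → Set} → (∀ v → Dec (P v)) → Dec (∃ P)
any-vector? zero    P? with P? []
... | yes p  = yes ([] , p)
... | no  ¬p = no λ { ([] , p) → ¬p p }
any-vector? (suc t) {P} P? with Fin.any? (λ x → any-vector? t (P? ∘ (x ∷_)))
... | yes (x , v , p) = yes (x ∷ v , p)
... | no  ∄           = no λ { (x ∷ v , p) → ∄ (x , v , p) }

image-cong : ∀ {a b} {f g : Fin a → Fin b} → (∀ i → f i ≡ g i) → ∀ F → image f F ≡ image g F
image-cong {zero}  f≗g []      = refl
image-cong {suc a} f≗g (x ∷ F) =
  cong₂ (λ u X → (if x then ⁅ u ⁆ else ⊥) ∪ X) (f≗g zero) (image-cong (f≗g ∘ suc) F)

module _ (H : Hypergraph) (n : ℕ) where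

  AdmissibleEdges : (Subset n → Bool) → Set
  AdmissibleEdges e = RSub (hg n e) H × ¬ Contains (hg n e) H

  rsub? : ∀ e → Dec (RSub (hg n e) H)
  rsub? e = all-subsets? λ F → (e F Bool.≟ true) →-dec
              anySubset? (λ F′ → (edge H F′ Bool.≟ true) ×-dec (∣ F′ ∣ ≟ ∣ F ∣))

  contains? : ∀ e → Dec (Contains (hg n e) H)
  contains? e with any-vector? (size H) embeds?
    where
    Embeds : Vec (Fin n) (size H) → Set
    Embeds v = (∀ i j → lookup v i ≡ lookup v j → i ≡ j) ×
               (∀ F → IsEdge H F → IsEdge (hg n e) (image (lookup v) F))
    embeds? : ∀ v → Dec (Embeds v)
    embeds? v = Fin.all? (λ i → Fin.all? λ j → (lookup v i Fin.≟ lookup v j) →-dec (i Fin.≟ j))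
                ×-dec all-subsets? (λ F → (edge H F Bool.≟ true) →-dec (e (image (lookup v) F) Bool.≟ true))
  ... | yes (v , injective , edges) = yes (lookup v , (λ {i} {j} → injective i j) , edges)
  ... | no  ∄ = no λ (f , f-injective , f-edges) → ∄ (tabulate f ,
          (λ i j eq → f-injective (trans (sym (lookup∘tabulate f i)) (trans eq (lookup∘tabulate f j)))) ,
          (λ F eF → trans (cong e (image-cong (lookup∘tabulate f) F)) (f-edges F eF)))

  admissible? : ∀ e → Dec (AdmissibleEdges e)
  admissible? e = rsub? e ×-dec ¬? (contains? e)

  admissible-cong : ∀ {e e′} → (∀ F → e F ≡ e′ F) → AdmissibleEdges e → AdmissibleEdges e′
  admissible-cong e≗e′ (sizes⊆ , H⊄) =
    (λ F e′F → sizes⊆ F (trans (e≗e′ F) e′F)) ,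
    (λ (f , f-injective , f-edges) → H⊄ (f , f-injective , λ F eF → trans (e≗e′ _) (f-edges F eF)))

  h-cong : ∀ {e e′} → (∀ F → e F ≡ e′ F) → h (hg n e) ≡ h (hg n e′)
  h-cong e≗e′ = cong (foldr ℚ._+_ 0ℚ)
    (map-cong (λ F → cong (λ b → if b then inv (n C ∣ F ∣) else 0ℚ) (e≗e′ F)) (allSubsets n))

  π-exists : ∀ e₀ → AdmissibleEdges e₀ → ∃ λ x → IsPiN H n x
  π-exists e₀ adm₀ = value best , (hg n best , (refl , best-admissible) , refl) , maximal
    where
    candidates = filter admissible? (edgeFunctions n)
    value : (Subset n → Bool) → ℚ
    value e = h (hg n e)
    best = Extrema.argmax value e₀ candidates
    best-admissible : AdmissibleEdges best
    best-admissible = Extrema.argmax-all value adm₀ (all-filter admissible? (edgeFunctions n))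
    maximal : ∀ G → Admissible H n G → h G ℚ.≤ value best
    maximal (hg .n e) (refl , adm) with e′ , e′∈ , e≗e′ ← edgeFunctions-complete n e =
      subst (ℚ._≤ value best) (sym (h-cong e≗e′))
        (All.lookup (Extrema.f[xs]≤f[argmax] e₀ candidates) (∈-filter⁺ admissible? e′∈ (admissible-cong e≗e′ adm)))

RSub⇒sizes : ∀ {G H} → RIs12 H → RSub G H → ∀ F → IsEdge G F → ∣ F ∣ ≡ 1 ⊎ ∣ F ∣ ≡ 2
RSub⇒sizes (sizes , _) sizes⊆ F e with sizes⊆ F e
... | F′ , e′ , ∣F′∣≡∣F∣ with sizes F′ e′
...   | inj₁ ∣F′∣≡1 = inj₁ (trans (sym ∣F′∣≡∣F∣) ∣F′∣≡1)
...   | inj₂ ∣F′∣≡2 = inj₂ (trans (sym ∣F′∣≡∣F∣) ∣F′∣≡2)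

1+1÷[1+M]≡[2+M]÷[1+M] : ∀ M → 1ℚ ℚ.+ 1 ÷ suc M ≡ suc (suc M) ÷ suc M
1+1÷[1+M]≡[2+M]÷[1+M] M = begin
  1ℚ ℚ.+ 1 ÷ suc M            ≡⟨ cong (ℚ._+ 1 ÷ suc M) (n÷n M) ⟨
  suc M ÷ suc M ℚ.+ 1 ÷ suc M ≡⟨ ÷-distribʳ-+ (suc M) 1 M ⟨
  (suc M + 1) ÷ suc M         ≡⟨ cong (_÷ suc M) (+-comm (suc M) 1) ⟩
  suc (suc M) ÷ suc M         ∎
  where open ≡-Reasoning

module _ (H : Hypergraph) (r12 : RIs12 H) where

  π≥1 : ∀ n → 2 ≤ n → ∀ x → IsPiN H n x → 1ℚ ℚ.≤ x
  π≥1 (suc (suc m)) _ x (_ , maximal) =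
    subst (ℚ._≤ x) (h[singletons]≡1 m) (maximal _ (singletons-admissible H r12 _))
  π≥1 1 (s≤s ())

  module _ (bipartite : TwoGraphBipartite H)
           (no-even-closed-path : ∀ k → ¬ Contains H (closedPath (suc (suc (k + k))))) where

    H-free-h≤ : ∀ M G → threshold (suc M) (size H) ≤ size G → RSub G H → ¬ Contains G H →
                h G ℚ.≤ 1ℚ ℚ.+ 1 ÷ suc M
    H-free-h≤ M (hg (suc (suc m)) e) N≤n sizes⊆ G⊉H = begin
      h G
        ≡⟨ h-formula m e (RSub⇒sizes r12 sizes⊆) ⟩
      (ones * suc m + 2 * pairs) ÷ (suc (suc m) * suc m)
        ≤⟨ ÷-mono-≤ (ones * suc m + 2 * pairs) _ (suc (suc M)) M density ⟩
      suc (suc M) ÷ suc M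
        ≡⟨ 1+1÷[1+M]≡[2+M]÷[1+M] M ⟨
      1ℚ ℚ.+ 1 ÷ suc M ∎
      where
      open ℚ.≤-Reasoning
      G : Hypergraph
      G = hg (suc (suc m)) e
      open Counting G
      density : (ones * suc m + 2 * pairs) * suc M ≤ suc (suc M) * (suc (suc m) * suc m)
      density = subst (_≤ suc (suc M) * (suc (suc m) * suc m)) (*-comm (suc M) (ones * suc m + 2 * pairs))
        (H-free-density H (proj₁ r12) bipartite no-even-closed-path (suc M) G N≤n G⊉H)
    H-free-h≤ M (hg 0 e) N≤n _ _ = contradiction (≤-trans (2≤threshold (suc M) (size H)) N≤n) λ ()
    H-free-h≤ M (hg 1 e) N≤n _ _ = contradiction (≤-trans (2≤threshold (suc M) (size H)) N≤n) λ { (s≤s ()) }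

    π≤1+1÷[1+M] : ∀ M n → threshold (suc M) (size H) ≤ n → ∀ x → IsPiN H n x → x ℚ.≤ 1ℚ ℚ.+ 1 ÷ suc M
    π≤1+1÷[1+M] M n N≤n x ((G , (refl , sizes⊆ , G⊉H) , refl) , _) = H-free-h≤ M G N≤n sizes⊆ G⊉H

mainTheorem10 : (H : Hypergraph) → RIs12 H → TwoGraphBipartite H →
    (∀ (k : ℕ) → ¬ Contains H (closedPath (suc (suc (k + k))))) →
    PiEq H 1ℚ
mainTheorem10 H r12 bipartite no-even-closed-path ε 0<ε = N , λ n N≤n →
  let x , x-isπₙ = π-exists H n _ (proj₂ (singletons-admissible H r12 n))
  in x , x-isπₙ , ∣x-y∣<ε (π≥1 H r12 n (≤-trans (2≤threshold (suc M) (size H)) N≤n) x x-isπₙ)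
                          (π≤1+1÷[1+M] H r12 bipartite no-even-closed-path M n N≤n x x-isπₙ)
                          1÷[1+M]<ε
  where
  M = proj₁ (∃-1÷<ε ε 0<ε)
  1÷[1+M]<ε = proj₂ (∃-1÷<ε ε 0<ε)
  N = threshold (suc M) (size H)
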